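{- Let $G$ be a finite connected undirected multigraph with vertices ordered $v_1,\dots,v_n$, where $q=v_n$, and identify $\mathrm{Div}(G)$ with $\mathbb{Z}^n$. Let $L$ be the Laplacian matrix and $\tilde L$ the reduced Laplacian. For each $v\in V$ let $\ell_v$ be a positive integer multiple of $\operatorname{ord}_q(v)$; let $\mathcal{S}_{[D]}=\{E\in\mathbb{E}_{[D]}:E(v)<\ell_v\text{ for all }v\}$. Let $\pi:\mathbb{Z}^n\to\prod_{v\in V}\mathbb{Z}/\ell_v\mathbb{Z}$ be the natural projection and, for $D\in\mathrm{Div}(G)$, let $H_{[D]}=\pi\big(D+(\operatorname{im}_{\mathbb{Z}}\tilde L\times\mathbb{Z})\big)$. Then: (1) $\tilde L$ is invertible over $\mathbb{Q}$, and for each $v\neq q$, $\operatorname{ord}_q(v)$ is the least common multiple of the denominators of the (reduced) fractions in the $v$-th column of $\tilde L^{ -1}$. (2) For each $[D]\in\operatorname{Jac}(G)$ (with $D$ of degree $0$), the map $\mathcal{S}_{[D]}\to H_{[D]}$, $E\mapsto\pi(E|_{q=0},\deg(E))$, is a bijection; thus $\mathcal{S}_{[D]}$ is exactly a set of standard representatives for $H_{[D]}$, where a standard representative of $\overline{D}\in\prod_v\mathbb{Z}/\ell_v\mathbb{Z}$ is an $E\in\mathbb{Z}^n$ with $\pi(E)=\overline D$ and $0\le E(v)<\ell_v$ for all $v$. (3) For each $[D]\in\operatorname{Jac}(G)$, $|\mathcal{S}_{[D]}|\cdot|\operatorname{Jac}(G)|=\prod_{v\in V}\ell_v$.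
   Context: $G$ is a finite connected undirected multigraph (loops allowed). Divisors are elements of $\mathbb{Z}^n$ (coordinates indexed by the ordered vertices), $\deg(D)=\sum_iD(v_i)$. The Laplacian matrix is $L=\mathrm{Deg}-A$, with $\mathrm{Deg}$ the diagonal matrix of vertex degrees and $A_{ij}$ the number of edges joining $v_i,v_j$. The reduced Laplacian $\tilde L$ is the $(n-1)\times(n-1)$ matrix obtained by deleting the row and column of $q$. $D\sim D'$ if $D-D'\in\operatorname{im}_{\mathbb{Z}}L$; $\operatorname{Jac}(G)$ is degree-$0$ divisors modulo $\operatorname{im}_{\mathbb{Z}}L$. $D|_{q=0}=\sum_{v\ne q}D(v)v\in\mathbb{Z}^{n-1}$. $E$ is effective if all $E(v)\ge0$; $|D|=\{E\ge0:E\sim D\}$; $\mathbb{E}_{[D]}=\bigcup_{k\ge0}|D+kq|$. $\operatorname{ord}_q(v)$ is the order of $[v-q]\in\operatorname{Jac}(G)$. -}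

module Defs where

open import Data.Nat as ℕ using (ℕ; zero; suc)
open import Data.Nat.LCM using (lcm)
open import Data.Integer as ℤ using (ℤ; +_)
open import Data.Integer.Divisibility as ℤDiv using ()
open import Data.Rational as ℚ using (ℚ; ↧ₙ_)
open import Data.Fin as Fin using (Fin; fromℕ; inject₁; _≟_)
open import Data.Product using (Σ; ∃; _×_; _,_)
open import Relation.Binary.PropositionalEquality using (_≡_)
open import Relation.Nullary using (yes; no)
open import Data.Nat.Divisibility using (_∣_)

sumℤ : ∀ {n} → (Fin n → ℤ) → ℤ
sumℤ {zero}  f = + 0
sumℤ {suc n} f = f Fin.zero ℤ.+ sumℤ (λ i → f (Fin.suc i))

sumℚ : ∀ {n} → (Fin n → ℚ) → ℚ
sumℚ {zero}  f = ℚ.0ℚ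
sumℚ {suc n} f = f Fin.zero ℚ.+ sumℚ (λ i → f (Fin.suc i))

prodℕ : ∀ {n} → (Fin n → ℕ) → ℕ
prodℕ {zero}  f = 1
prodℕ {suc n} f = f Fin.zero ℕ.* prodℕ (λ i → f (Fin.suc i))

lcmℕ : ∀ {n} → (Fin n → ℕ) → ℕ
lcmℕ {zero}  f = 1
lcmℕ {suc n} f = lcm (f Fin.zero) (lcmℕ (λ i → f (Fin.suc i)))

-- Multigraphs on vertices v₁ … vₙ = Fin n.  A i j = number of edges
-- joining vᵢ and vⱼ (A i i = number of loops at vᵢ).

Adj : ℕ → Set
Adj n = Fin n → Fin n → ℕ

Symmetric : ∀ {n} → Adj n → Set
Symmetric A = ∀ i j → A i j ≡ A j i

data Reach {n} (A : Adj n) (i : Fin n) : Fin n → Set where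
  here : Reach A i i
  step : ∀ {j k} → Reach A i j → 0 ℕ.< A j k → Reach A i k

Connected : ∀ {n} → Adj n → Set
Connected A = ∀ i j → Reach A i j

sumℕ : ∀ {n} → (Fin n → ℕ) → ℕ
sumℕ {zero}  f = 0
sumℕ {suc n} f = f Fin.zero ℕ.+ sumℕ (λ i → f (Fin.suc i))

δ : ∀ {n} {A : Set} → A → A → Fin n → Fin n → A
δ one zer i j with i ≟ j
... | yes _ = one
... | no  _ = zer

-- vertex degree Deg(v) = Σⱼ A v j  (a loop at v counts once, so that
-- loops do not affect the Laplacian)
vdeg : ∀ {n} → Adj n → Fin n → ℕ
vdeg A i = sumℕ (λ j → A i j)

Lap : ∀ {n} → Adj n → Fin n → Fin n → ℤ
Lap A i j = δ (+ vdeg A i) (+ 0) i j ℤ.- + A i j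

Div : ℕ → Set
Div n = Fin n → ℤ

q : ∀ m → Fin (suc m)
q m = fromℕ m

degD : ∀ {n} → Div n → ℤ
degD D = sumℤ D

vtx : ∀ {n} → Fin n → Div n
vtx v w = δ (+ 1) (+ 0) v w

InImL : ∀ {n} → Adj n → Div n → Set
InImL A x = Σ (Div _) λ z → ∀ i → x i ≡ sumℤ (λ j → Lap A i j ℤ.* z j)

LinEq : ∀ {n} → Adj n → Div n → Div n → Set
LinEq A D D' = InImL A (λ i → D i ℤ.- D' i)

IsOrd : ∀ {m} → Adj (suc m) → Fin (suc m) → ℕ → Set
IsOrd {m} A v k =
  0 ℕ.< k
  × InImL A (λ w → + k ℤ.* (vtx v w ℤ.- vtx (q m) w))
  × (∀ k' → 0 ℕ.< k' → InImL A (λ w → + k' ℤ.* (vtx v w ℤ.- vtx (q m) w)) → k ℕ.≤ k')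

PosMultOfOrd : ∀ {m} → Adj (suc m) → Fin (suc m) → ℕ → Set
PosMultOfOrd A v ℓ = Σ ℕ λ k → IsOrd A v k × 0 ℕ.< ℓ × k ∣ ℓ

Lred : ∀ {m} → Adj (suc m) → Fin m → Fin m → ℤ
Lred A i j = Lap A (inject₁ i) (inject₁ j)

toℚ : ℤ → ℚ
toℚ z = z ℚ./ 1

IsInverseℚ : ∀ {m} → (Fin m → Fin m → ℤ) → (Fin m → Fin m → ℚ) → Set
IsInverseℚ N M =
  (∀ i j → sumℚ (λ k → toℚ (N i k) ℚ.* M k j) ≡ δ ℚ.1ℚ ℚ.0ℚ i j)
  × (∀ i j → sumℚ (λ k → M i k ℚ.* toℚ (N k j)) ≡ δ ℚ.1ℚ ℚ.0ℚ i j)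

lcmDenCol : ∀ {m} → (Fin m → Fin m → ℚ) → Fin m → ℕ
lcmDenCol M v = lcmℕ (λ i → ↧ₙ (M i v))

Effective : ∀ {n} → Div n → Set
Effective E = ∀ v → + 0 ℤ.≤ E v

-- E ∈ 𝔼_[D] = ⋃_{k ≥ 0} |D + k q|
InEE : ∀ {m} → Adj (suc m) → Div (suc m) → Div (suc m) → Set
InEE {m} A D E = Effective E × Σ ℕ λ k → LinEq A E (λ w → D w ℤ.+ + k ℤ.* vtx (q m) w)

InS : ∀ {m} → Adj (suc m) → (Fin (suc m) → ℕ) → Div (suc m) → Div (suc m) → Set
InS A ℓ D E = InEE A D E × (∀ v → E v ℤ.< + ℓ v)

-- x ≡ y in ∏_v ℤ/ℓ_v ℤ, i.e. π x = π y
ModEq : ∀ {n} → (Fin n → ℕ) → Div n → Div n → Set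
ModEq ℓ x y = ∀ v → (+ ℓ v) ℤDiv.∣ (x v ℤ.- y v)

InCoset : ∀ {m} → Adj (suc m) → Div (suc m) → Div (suc m) → Set
InCoset {m} A D w = Σ (Fin m → ℤ) λ y → Σ ℤ λ t →
  (∀ i → w (inject₁ i) ≡ D (inject₁ i) ℤ.+ sumℤ (λ j → Lred A i j ℤ.* y j))
  × w (q m) ≡ D (q m) ℤ.+ t

InH : ∀ {m} → Adj (suc m) → (Fin (suc m) → ℕ) → Div (suc m) → Div (suc m) → Set
InH A ℓ D x = Σ (Div _) λ w → InCoset A D w × ModEq ℓ x w

resDeg : ∀ {m} → Div (suc m) → Div (suc m)
resDeg {m} E v with v ≟ q m
... | yes _ = degD E
... | no  _ = E v

-- Cardinality of a subset P of A modulo an equivalence R: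
-- an enumeration Fin N → A hitting each R-class of P exactly once.

HasCard : {A : Set} → (A → Set) → (A → A → Set) → ℕ → Set
HasCard {A} P R N = Σ (Fin N → A) λ f →
  (∀ i → P (f i))
  × (∀ i j → R (f i) (f j) → i ≡ j)
  × (∀ a → P a → Σ (Fin N) λ i → R a (f i))

PtEq : ∀ {n} → Div n → Div n → Set
PtEq x y = ∀ v → x v ≡ y v

CardS : ∀ {m} → Adj (suc m) → (Fin (suc m) → ℕ) → Div (suc m) → ℕ → Set
CardS A ℓ D N = HasCard (InS A ℓ D) PtEq N

CardJac : ∀ {n} → Adj n → ℕ → Set
CardJac A N = HasCard (λ D → degD D ≡ + 0) (LinEq A) N

-- Every ord_q(v) is finite, so for each v ≠ q some k e_v (k > 0) lies in im_ℤ L̃, say L̃ y_v = k e_v;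
-- the columns y_v / k form a rational right inverse of L̃, which is two-sided because L̃ is symmetric.
-- Then x ∈ im_ℤ L̃ iff L̃⁻¹ x is integral, so k e_v ∈ im_ℤ L̃ iff every denominator in column v of L̃⁻¹
-- divides k, and ord_q(v) is the lcm of these denominators.
--
-- Restricting to V ∖ {q} identifies degree-0 divisors modulo im_ℤ L with ℤ^{V∖q} modulo H = im_ℤ L̃,
-- and H contains ∏_{v≠q} ℓ_v ℤ because ℓ_v e_v ∈ H. A divisor E with 0 ≤ E < ℓ lies in 𝒮_[D] exactly
-- when E|_{q=0} − D|_{q=0} ∈ H (take k = deg E), while E(q) ∈ [0, ℓ_q) is free. Hence E is recovered
-- from (E|_{q=0}, deg E) modulo ℓ, and |𝒮_[D]| = ℓ_q · |H ∩ B| for the box B = ∏_{v≠q} [0, ℓ_v).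
-- Lagrange's theorem in B, read modulo ℓ, gives |B| = [ℤ^{V∖q} : H] · |H ∩ B| = |Jac(G)| · |H ∩ B|.

module Submission where

open import Level using (0ℓ)
open import Algebra.Bundles using (CommutativeRing; AbelianGroup)
open import Data.Nat as ℕ using (ℕ; zero; suc; NonZero)
import Data.Nat.Properties as ℕP
import Data.Nat.DivMod as ℕDM
open import Data.Fin as Fin using (Fin; zero; suc; inject₁; fromℕ)
import Data.Fin.Properties as FinP
import Algebra.Properties.Semiring.Sum as SemiringSum
open import Data.Vec.Functional using (Vector)
open import Data.Product using (Σ; _×_; _,_; proj₁; proj₂)
open import Function using (_∘_; id)
open import Relation.Binary.PropositionalEquality
  using (_≡_; _≢_; refl; sym; trans; cong; cong₂; subst; subst₂; module ≡-Reasoning)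
open import Relation.Nullary using (Dec; yes; no; ¬_; contradiction)
open import Data.Empty using (⊥-elim)
open import Relation.Binary.Definitions using (tri<; tri≈; tri>)
open import Data.Integer as ℤ using (ℤ; +_; -_; +≤+; +<+)
import Data.Integer.Divisibility as ℤDiv
import Data.Integer.Divisibility.Signed as Sg
open import Data.Integer.DivMod using (_%ℕ_; _/ℕ_; n%ℕd<d; a≡a%ℕn+[a/ℕn]*n)
import Data.Integer.Properties as ℤP
open import Data.Rational as ℚ using (ℚ; mkℚ; ↧ₙ_)
import Data.Rational.Properties as ℚP
open import Data.Rational.Unnormalised as ℚᵘ using (mkℚᵘ; *≡*)
import Data.Rational.Unnormalised.Properties as ℚᵘP
open import Data.Nat.Divisibility using (_∣_; divides; _∣?_; ∣-trans; 1∣_; 0∣⇒≡0; ∣⇒≤; >⇒∤)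
open import Data.Nat.LCM using (m∣lcm[m,n]; n∣lcm[m,n]; lcm-least)
open import Data.Nat.Coprimality using (Coprime; coprime?; coprime-divisor) renaming (sym to Coprime-sym)
open import Relation.Nullary.Decidable using (recompute)
open import Data.Integer.Tactic.RingSolver using (solve-∀)
open import Algebra.Properties.Group (AbelianGroup.group ℤP.+-0-abelianGroup) using () renaming (∙-cancelˡ to +-cancelˡ)
open import Defs

module _ {A : Set} {a b : A} where

  δ-≡ : ∀ {n} {i j : Fin n} → i ≡ j → δ a b i j ≡ a
  δ-≡ {i = i} {j} i≡j with i Fin.≟ j
  ... | yes _ = refl
  ... | no i≢j = ⊥-elim (i≢j i≡j)

  δ-≢ : ∀ {n} {i j : Fin n} → i ≢ j → δ a b i j ≡ b
  δ-≢ {i = i} {j} i≢j with i Fin.≟ j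
  ... | yes i≡j = ⊥-elim (i≢j i≡j)
  ... | no _ = refl

  δ-cong : ∀ {n k} {i j : Fin n} {i′ j′ : Fin k} →
           (i ≡ j → i′ ≡ j′) → (i′ ≡ j′ → i ≡ j) → δ a b i j ≡ δ a b i′ j′
  δ-cong {i = i} {j} to from with i Fin.≟ j
  ... | yes i≡j = sym (δ-≡ (to i≡j))
  ... | no i≢j = sym (δ-≢ (i≢j ∘ from))

  δ-sym : ∀ {n} (i j : Fin n) → δ a b i j ≡ δ a b j i
  δ-sym i j = δ-cong sym sym

  δ-suc : ∀ {n} (i j : Fin n) → δ a b (suc i) (suc j) ≡ δ a b i j
  δ-suc i j = δ-cong FinP.suc-injective (cong suc)

  δ-inject₁ : ∀ {n} (i j : Fin n) → δ a b (inject₁ i) (inject₁ j) ≡ δ a b i j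
  δ-inject₁ i j = δ-cong FinP.inject₁-injective (cong inject₁)

  δ-fromℕ-inject₁ : ∀ {n} (i : Fin n) → δ a b (fromℕ n) (inject₁ i) ≡ b
  δ-fromℕ-inject₁ i = δ-≢ FinP.fromℕ≢inject₁

δ-map : ∀ {A B : Set} (f : A → B) {a b n} (i j : Fin n) → f (δ a b i j) ≡ δ (f a) (f b) i j
δ-map f i j with i Fin.≟ j
... | yes _ = refl
... | no _ = refl

module FiniteSums (R : CommutativeRing 0ℓ 0ℓ)
  (≈⇒≡ : ∀ {x y} → CommutativeRing._≈_ R x y → x ≡ y)
  (∑ : ∀ {n} → Vector (CommutativeRing.Carrier R) n → CommutativeRing.Carrier R)
  (∑≗sum : ∀ {n} f → ∑ {n} f ≡ SemiringSum.sum (CommutativeRing.semiring R) f) where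

  open CommutativeRing R using (Carrier; _≈_; semiring; _+_; _*_; 0#; 1#;
    +-identityˡ; +-identityʳ; *-identityˡ; zeroˡ; *-comm; *-assoc)

  open SemiringSum semiring using (sum; sum-cong-≗; sum-replicate-zero; ∑-distrib-+; ∑-comm;
    *-distribˡ-sum; *-distribʳ-sum; sum-init-last)
  open ≡-Reasoning

  private
    via-sum : ∀ {n} {f : Vector Carrier n} {x} → sum f ≈ x → ∑ f ≡ x
    via-sum {f = f} e = trans (∑≗sum f) (≈⇒≡ e)

  ∑-cong : ∀ {n} {f g : Vector Carrier n} → (∀ i → f i ≡ g i) → ∑ f ≡ ∑ g
  ∑-cong {f = f} {g} f≗g = trans (∑≗sum f) (trans (sum-cong-≗ f≗g) (sym (∑≗sum g)))

  ∑-zero : ∀ {n} → ∑ {n} (λ _ → 0#) ≡ 0#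
  ∑-zero {n} = via-sum (sum-replicate-zero n)

  ∑-+ : ∀ {n} (f g : Vector Carrier n) → ∑ (λ i → f i + g i) ≡ ∑ f + ∑ g
  ∑-+ f g = trans (via-sum (∑-distrib-+ f g)) (sym (cong₂ _+_ (∑≗sum f) (∑≗sum g)))

  ∑-*ˡ : ∀ {n} c (f : Vector Carrier n) → ∑ (λ i → c * f i) ≡ c * ∑ f
  ∑-*ˡ c f = trans (∑≗sum _) (trans (sym (≈⇒≡ (*-distribˡ-sum c f))) (sym (cong (c *_) (∑≗sum f))))

  ∑-*ʳ : ∀ {n} c (f : Vector Carrier n) → ∑ (λ i → f i * c) ≡ ∑ f * c
  ∑-*ʳ c f = trans (∑≗sum _) (trans (sym (≈⇒≡ (*-distribʳ-sum c f))) (sym (cong (_* c) (∑≗sum f))))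

  ∑-swap : ∀ {n k} (f : Fin n → Fin k → Carrier) →
           ∑ (λ i → ∑ (λ j → f i j)) ≡ ∑ (λ j → ∑ (λ i → f i j))
  ∑-swap f = begin
    ∑ (λ i → ∑ (f i))             ≡⟨ ∑-cong (λ i → ∑≗sum (f i)) ⟩
    ∑ (λ i → sum (f i))           ≡⟨ via-sum (∑-comm f) ⟩
    sum (λ j → sum (λ i → f i j)) ≡⟨ sum-cong-≗ (λ j → ∑≗sum (λ i → f i j)) ⟨
    sum (λ j → ∑ (λ i → f i j))   ≡⟨ ∑≗sum _ ⟨
    ∑ (λ j → ∑ (λ i → f i j))     ∎

  ∑-init-last : ∀ {n} (f : Vector Carrier (suc n)) → ∑ f ≡ ∑ (f ∘ inject₁) + f (fromℕ n)
  ∑-init-last f = trans (via-sum (sum-init-last f)) (cong (_+ f (fromℕ _)) (sym (∑≗sum (f ∘ inject₁))))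

  ∑-δ : ∀ {n} (i : Fin n) (g : Vector Carrier n) → ∑ (λ j → δ (g j) 0# i j) ≡ g i
  ∑-δ i g = trans (∑≗sum _) (sum-δ i g)
    where
    sum-δ : ∀ {n} (i : Fin n) (g : Vector Carrier n) → sum (λ j → δ (g j) 0# i j) ≡ g i
    sum-δ {suc n} zero g = begin
      g zero + sum {n} (λ _ → 0#) ≡⟨ cong (_+_ (g zero)) (≈⇒≡ (sum-replicate-zero n)) ⟩
      g zero + 0#                 ≡⟨ ≈⇒≡ (+-identityʳ _) ⟩
      g zero                      ∎
    sum-δ {suc n} (suc i) g = begin
      0# + sum {n} (λ j → δ (g (suc j)) 0# (suc i) (suc j))
        ≡⟨ cong (_+_ 0#) (sum-cong-≗ {n} (λ j → δ-suc i j)) ⟩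
      0# + sum (λ j → δ (g (suc j)) 0# i j) ≡⟨ cong (_+_ 0#) (sum-δ i (g ∘ suc)) ⟩
      0# + g (suc i)                        ≡⟨ ≈⇒≡ (+-identityˡ _) ⟩
      g (suc i)                             ∎

  ∑-δ* : ∀ {n} (i : Fin n) (f : Vector Carrier n) → ∑ (λ j → δ 1# 0# i j * f j) ≡ f i
  ∑-δ* i f = trans (∑-cong unit) (∑-δ i f)
    where
    unit : ∀ j → δ 1# 0# i j * f j ≡ δ (f j) 0# i j
    unit j = trans (δ-map (_* f j) i j) (cong₂ (λ x y → δ x y i j) (≈⇒≡ (*-identityˡ _)) (≈⇒≡ (zeroˡ _)))

  ∑-*δ : ∀ {n} (i : Fin n) (f : Vector Carrier n) → ∑ (λ j → f j * δ 1# 0# j i) ≡ f i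
  ∑-*δ i f = trans (∑-cong (λ j → trans (≈⇒≡ (*-comm _ _)) (cong (_* f j) (δ-sym j i)))) (∑-δ* i f)

  infixr 7 _*ᵥ_ _*ₘ_

  _*ᵥ_ : ∀ {n k} → (Fin n → Fin k → Carrier) → Vector Carrier k → Vector Carrier n
  (M *ᵥ x) i = ∑ (λ j → M i j * x j)

  _*ₘ_ : ∀ {n k l} → (Fin n → Fin k → Carrier) → (Fin k → Fin l → Carrier) → Fin n → Fin l → Carrier
  (M *ₘ N) i j = ∑ (λ k → M i k * N k j)

  *ᵥ-assoc : ∀ {n k l} (M : Fin n → Fin k → Carrier) (N : Fin k → Fin l → Carrier) x i →
             (M *ᵥ N *ᵥ x) i ≡ ((M *ₘ N) *ᵥ x) i
  *ᵥ-assoc M N x i = begin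
    ∑ (λ j → M i j * ∑ (λ l → N j l * x l))   ≡⟨ ∑-cong (λ j → sym (∑-*ˡ (M i j) _)) ⟩
    ∑ (λ j → ∑ (λ l → M i j * (N j l * x l))) ≡⟨ ∑-swap _ ⟩
    ∑ (λ l → ∑ (λ j → M i j * (N j l * x l))) ≡⟨ ∑-cong (λ l → ∑-cong (λ j → sym (≈⇒≡ (*-assoc _ _ _)))) ⟩
    ∑ (λ l → ∑ (λ j → (M i j * N j l) * x l)) ≡⟨ ∑-cong (λ l → ∑-*ʳ (x l) _) ⟩
    ∑ (λ l → (M *ₘ N) i l * x l)             ∎

  Inverse : ∀ {n} → (Fin n → Fin n → Carrier) → (Fin n → Fin n → Carrier) → Set
  Inverse N M = ∀ i j → (N *ₘ M) i j ≡ δ 1# 0# i j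

  symmetric-inverseʳ⇒inverseˡ : ∀ {n} (N M : Fin n → Fin n → Carrier) → (∀ i j → N i j ≡ N j i) →
                                Inverse N M → Inverse M N
  symmetric-inverseʳ⇒inverseˡ N M N-sym NM≡I i j = trans (∑-cong (λ k → cong (_* N k j) (M-sym i k))) (MᵀN≡I i j)
    where
    MᵀN≡I : ∀ i j → ∑ (λ k → M k i * N k j) ≡ δ 1# 0# i j
    MᵀN≡I i j = begin
      ∑ (λ k → M k i * N k j) ≡⟨ ∑-cong (λ k → trans (≈⇒≡ (*-comm _ _)) (cong (_* M k i) (N-sym k j))) ⟩
      (N *ₘ M) j i            ≡⟨ NM≡I j i ⟩
      δ 1# 0# j i             ≡⟨ δ-sym j i ⟩
      δ 1# 0# i j             ∎
    M-sym : ∀ i j → M i j ≡ M j i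
    M-sym i j = begin
      M i j                                       ≡⟨ ∑-δ* i (λ k → M k j) ⟨
      ∑ (λ k → δ 1# 0# i k * M k j)               ≡⟨ ∑-cong (λ k → cong (_* M k j) (MᵀN≡I i k)) ⟨
      ∑ (λ k → ∑ (λ l → M l i * N l k) * M k j)   ≡⟨ *ᵥ-assoc (λ a b → M b a) N (λ k → M k j) i ⟨
      ∑ (λ l → M l i * (N *ₘ M) l j)              ≡⟨ ∑-cong (λ l → cong (M l i *_) (NM≡I l j)) ⟩
      ∑ (λ l → M l i * δ 1# 0# l j)               ≡⟨ ∑-*δ j (λ l → M l i) ⟩
      M j i                                       ∎

∑ℤ≗sum : ∀ {n} (f : Fin n → ℤ) → sumℤ f ≡ SemiringSum.sum (CommutativeRing.semiring ℤP.+-*-commutativeRing) f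
∑ℤ≗sum {zero}  f = refl
∑ℤ≗sum {suc n} f = cong (ℤ._+_ (f zero)) (∑ℤ≗sum (f ∘ suc))

∑ℚ≗sum : ∀ {n} (f : Fin n → ℚ) → sumℚ f ≡ SemiringSum.sum (CommutativeRing.semiring ℚP.+-*-commutativeRing) f
∑ℚ≗sum {zero}  f = refl
∑ℚ≗sum {suc n} f = cong (ℚ._+_ (f zero)) (∑ℚ≗sum (f ∘ suc))

module ℤSum = FiniteSums ℤP.+-*-commutativeRing id sumℤ ∑ℤ≗sum
module ℚSum = FiniteSums ℚP.+-*-commutativeRing id sumℚ ∑ℚ≗sum

∑-neg : ∀ {n} (f : Fin n → ℤ) → sumℤ (λ i → - f i) ≡ - sumℤ f
∑-neg {zero}  f = refl
∑-neg {suc n} f = trans (cong (ℤ._+_ (- f zero)) (∑-neg (f ∘ suc))) (sym (ℤP.neg-distrib-+ (f zero) _))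

∑-- : ∀ {n} (f g : Fin n → ℤ) → sumℤ (λ i → f i ℤ.- g i) ≡ sumℤ f ℤ.- sumℤ g
∑-- f g = trans (ℤSum.∑-+ f (λ i → - g i)) (cong (ℤ._+_ (sumℤ f)) (∑-neg g))

∑-nonneg : ∀ {n} (f : Fin n → ℤ) → (∀ i → + 0 ℤ.≤ f i) → + 0 ℤ.≤ sumℤ f
∑-nonneg {zero}  f f≥0 = ℤP.≤-refl
∑-nonneg {suc n} f f≥0 = ℤP.+-mono-≤ (f≥0 zero) (∑-nonneg (f ∘ suc) (f≥0 ∘ suc))

∑-pos : ∀ {n} (f : Fin n → ℕ) → + sumℕ f ≡ sumℤ (λ i → + f i)
∑-pos {zero}  f = refl
∑-pos {suc n} f = trans (ℤP.pos-+ (f zero) _) (cong (ℤ._+_ (+ f zero)) (∑-pos (f ∘ suc)))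

toℚᵘ-toℚ : ∀ z → ℚ.toℚᵘ (toℚ z) ℚᵘ.≃ mkℚᵘ z 0
toℚᵘ-toℚ z = ℚP.toℚᵘ-fromℚᵘ (mkℚᵘ z 0)

toℚ-+ : ∀ a b → toℚ (a ℤ.+ b) ≡ toℚ a ℚ.+ toℚ b
toℚ-+ a b = ℚP.toℚᵘ-injective (begin
  ℚ.toℚᵘ (toℚ (a ℤ.+ b))
    ≈⟨ toℚᵘ-toℚ _ ⟩
  mkℚᵘ (a ℤ.+ b) 0
    ≈⟨ *≡* (cong (ℤ._* + 1) (sym (cong₂ ℤ._+_ (ℤP.*-identityʳ a) (ℤP.*-identityʳ b)))) ⟩
  mkℚᵘ a 0 ℚᵘ.+ mkℚᵘ b 0
    ≈⟨ ℚᵘP.+-cong (toℚᵘ-toℚ a) (toℚᵘ-toℚ b) ⟨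
  ℚ.toℚᵘ (toℚ a) ℚᵘ.+ ℚ.toℚᵘ (toℚ b)
    ≈⟨ ℚP.toℚᵘ-homo-+ (toℚ a) (toℚ b) ⟨
  ℚ.toℚᵘ (toℚ a ℚ.+ toℚ b)            ∎)
  where open ℚᵘP.≃-Reasoning

toℚ-* : ∀ a b → toℚ (a ℤ.* b) ≡ toℚ a ℚ.* toℚ b
toℚ-* a b = ℚP.toℚᵘ-injective (begin
  ℚ.toℚᵘ (toℚ (a ℤ.* b))              ≈⟨ toℚᵘ-toℚ _ ⟩
  mkℚᵘ a 0 ℚᵘ.* mkℚᵘ b 0               ≈⟨ ℚᵘP.*-cong (toℚᵘ-toℚ a) (toℚᵘ-toℚ b) ⟨
  ℚ.toℚᵘ (toℚ a) ℚᵘ.* ℚ.toℚᵘ (toℚ b)  ≈⟨ ℚP.toℚᵘ-homo-* (toℚ a) (toℚ b) ⟨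
  ℚ.toℚᵘ (toℚ a ℚ.* toℚ b)            ∎)
  where open ℚᵘP.≃-Reasoning

toℚ-injective : ∀ {a b} → toℚ a ≡ toℚ b → a ≡ b
toℚ-injective {a} {b} eq with ℚᵘP.≃-trans (ℚᵘP.≃-sym (toℚᵘ-toℚ a)) (ℚᵘP.≃-trans (ℚP.toℚᵘ-cong eq) (toℚᵘ-toℚ b))
... | *≡* a*1≡b*1 = trans (sym (ℤP.*-identityʳ a)) (trans a*1≡b*1 (ℤP.*-identityʳ b))

toℚ-∑ : ∀ {n} (f : Fin n → ℤ) → toℚ (sumℤ f) ≡ sumℚ (λ i → toℚ (f i))
toℚ-∑ {zero}  f = refl
toℚ-∑ {suc n} f = trans (toℚ-+ (f zero) _) (cong (ℚ._+_ (toℚ (f zero))) (toℚ-∑ (f ∘ suc)))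

toℚᵐ : ∀ {n k} → (Fin n → Fin k → ℤ) → Fin n → Fin k → ℚ
toℚᵐ N i j = toℚ (N i j)

toℚ-*ᵥ : ∀ {n k} (M : Fin n → Fin k → ℤ) x i →
         toℚ ((M ℤSum.*ᵥ x) i) ≡ (toℚᵐ M ℚSum.*ᵥ toℚ ∘ x) i
toℚ-*ᵥ M x i = trans (toℚ-∑ (λ j → M i j ℤ.* x j)) (ℚSum.∑-cong (λ j → toℚ-* (M i j) (x j)))

toℚ-δ : ∀ {n} (i j : Fin n) → toℚ (δ (+ 1) (+ 0) i j) ≡ δ ℚ.1ℚ ℚ.0ℚ i j
toℚ-δ = δ-map toℚ

IsIntegral : ℚ → Set
IsIntegral r = Σ ℤ λ z → toℚ z ≡ r

integral-multiple⇒↧ₙ∣ : ∀ k r → IsIntegral (toℚ (+ k) ℚ.* r) → ↧ₙ r ∣ k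
integral-multiple⇒↧ₙ∣ k r@(mkℚ n d-1 n⊥d) (z , z≡kr)
  with ℚᵘP.≃-trans (ℚᵘP.≃-sym (toℚᵘ-toℚ z))
         (ℚᵘP.≃-trans (ℚP.toℚᵘ-cong z≡kr)
           (ℚᵘP.≃-trans (ℚP.toℚᵘ-homo-* (toℚ (+ k)) r) (ℚᵘP.*-cong (toℚᵘ-toℚ (+ k)) (ℚᵘP.≃-refl {mkℚᵘ n d-1}))))
... | *≡* eq = coprime-divisor d⊥n (divides ℤ.∣ z ∣ ∣n∣k≡∣z∣d)
  where
  d⊥n : Coprime (suc d-1) ℤ.∣ n ∣
  d⊥n = recompute (coprime? (suc d-1) ℤ.∣ n ∣) (Coprime-sym n⊥d)
  z*d≡k*n : z ℤ.* + suc d-1 ≡ + k ℤ.* n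
  z*d≡k*n = trans (cong (λ t → z ℤ.* + t) (sym (ℕP.*-identityˡ (suc d-1)))) (trans eq (ℤP.*-identityʳ _))
  ∣n∣k≡∣z∣d : ℤ.∣ n ∣ ℕ.* k ≡ ℤ.∣ z ∣ ℕ.* suc d-1
  ∣n∣k≡∣z∣d = trans (ℕP.*-comm ℤ.∣ n ∣ k)
    (trans (sym (ℤP.abs-* (+ k) n)) (trans (cong ℤ.∣_∣ (sym z*d≡k*n)) (ℤP.abs-* z (+ suc d-1))))

↧ₙ∣⇒integral-multiple : ∀ k r → ↧ₙ r ∣ k → IsIntegral (toℚ (+ k) ℚ.* r)
↧ₙ∣⇒integral-multiple k r@(mkℚ n d-1 _) (divides t k≡td) = + t ℤ.* n , ℚP.toℚᵘ-injective (begin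
  ℚ.toℚᵘ (toℚ (+ t ℤ.* n))                ≈⟨ toℚᵘ-toℚ _ ⟩
  mkℚᵘ (+ t ℤ.* n) 0                      ≈⟨ *≡* t*n*1≡k*n*1 ⟩
  mkℚᵘ (+ k) 0 ℚᵘ.* mkℚᵘ n d-1            ≈⟨ ℚᵘP.*-cong (toℚᵘ-toℚ (+ k)) (ℚᵘP.≃-refl {mkℚᵘ n d-1}) ⟨
  ℚ.toℚᵘ (toℚ (+ k)) ℚᵘ.* mkℚᵘ n d-1      ≈⟨ ℚP.toℚᵘ-homo-* (toℚ (+ k)) r ⟨
  ℚ.toℚᵘ (toℚ (+ k) ℚ.* r)                ∎)
  where
  open ℚᵘP.≃-Reasoning
  t*n*1≡k*n*1 : (+ t ℤ.* n) ℤ.* + (1 ℕ.* suc d-1) ≡ (+ k ℤ.* n) ℤ.* + 1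
  t*n*1≡k*n*1 = trans (cong (λ x → (+ t ℤ.* n) ℤ.* + x) (ℕP.*-identityˡ (suc d-1)))
    (trans (regroup (+ t) n (+ suc d-1))
      (cong (λ x → x ℤ.* n ℤ.* + 1) (trans (sym (ℤP.pos-* t (suc d-1))) (cong +_ (sym k≡td)))))
    where
    regroup : ∀ a b c → (a ℤ.* b) ℤ.* c ≡ (a ℤ.* c) ℤ.* b ℤ.* + 1
    regroup = solve-∀

integral? : ∀ r → Dec (IsIntegral r)
integral? r with ↧ₙ r ∣? 1
... | yes ↧ₙr∣1 = let (z , e) = ↧ₙ∣⇒integral-multiple 1 r ↧ₙr∣1 in yes (z , trans e (ℚP.*-identityˡ r))
... | no ↧ₙr∤1 = no λ (z , e) → ↧ₙr∤1 (integral-multiple⇒↧ₙ∣ 1 r (z , trans e (sym (ℚP.*-identityˡ r))))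

∣lcmℕ : ∀ {n} (f : Fin n → ℕ) i → f i ∣ lcmℕ f
∣lcmℕ f zero    = m∣lcm[m,n] _ _
∣lcmℕ f (suc i) = ∣-trans (∣lcmℕ (f ∘ suc) i) (n∣lcm[m,n] (f zero) _)

lcmℕ-least : ∀ {n} (f : Fin n → ℕ) {c} → (∀ i → f i ∣ c) → lcmℕ f ∣ c
lcmℕ-least {zero}  f {c} f∣c = 1∣ c
lcmℕ-least {suc n} f     f∣c = lcm-least (f∣c zero) (lcmℕ-least (f ∘ suc) (f∣c ∘ suc))

InIm : ∀ {n k} → (Fin n → Fin k → ℤ) → (Fin n → ℤ) → Set
InIm N x = Σ (Fin _ → ℤ) λ y → ∀ i → x i ≡ (N ℤSum.*ᵥ y) i

module Image {n k : ℕ} (N : Fin n → Fin k → ℤ) where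
  open ℤSum using (_*ᵥ_; ∑-cong; ∑-+; ∑-*ˡ; ∑-zero)

  InIm-cong : ∀ {x x′} → (∀ i → x i ≡ x′ i) → InIm N x → InIm N x′
  InIm-cong x≗x′ (y , x≡Ny) = y , λ i → trans (sym (x≗x′ i)) (x≡Ny i)

  InIm-0 : InIm N (λ _ → + 0)
  InIm-0 = (λ _ → + 0) , λ i → sym (trans (∑-cong (λ j → ℤP.*-zeroʳ (N i j))) (∑-zero {k}))

  InIm-+ : ∀ {x x′} → InIm N x → InIm N x′ → InIm N (λ i → x i ℤ.+ x′ i)
  InIm-+ {x} {x′} (y , x≡Ny) (y′ , x′≡Ny′) = (λ j → y j ℤ.+ y′ j) , λ i → begin
    x i ℤ.+ x′ i                          ≡⟨ cong₂ ℤ._+_ (x≡Ny i) (x′≡Ny′ i) ⟩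
    (N *ᵥ y) i ℤ.+ (N *ᵥ y′) i            ≡⟨ ∑-+ (λ j → N i j ℤ.* y j) (λ j → N i j ℤ.* y′ j) ⟨
    sumℤ (λ j → N i j ℤ.* y j ℤ.+ N i j ℤ.* y′ j) ≡⟨ ∑-cong (λ j → ℤP.*-distribˡ-+ (N i j) (y j) (y′ j)) ⟨
    (N *ᵥ (λ j → y j ℤ.+ y′ j)) i         ∎
    where open ≡-Reasoning

  InIm-* : ∀ c {x} → InIm N x → InIm N (λ i → c ℤ.* x i)
  InIm-* c {x} (y , x≡Ny) = (λ j → c ℤ.* y j) , λ i → begin
    c ℤ.* x i                             ≡⟨ cong (c ℤ.*_) (x≡Ny i) ⟩
    c ℤ.* (N *ᵥ y) i                      ≡⟨ ∑-*ˡ c (λ j → N i j ℤ.* y j) ⟨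
    sumℤ (λ j → c ℤ.* (N i j ℤ.* y j))   ≡⟨ ∑-cong (λ j → swap-factors c (N i j) (y j)) ⟩
    (N *ᵥ (λ j → c ℤ.* y j)) i            ∎
    where
    open ≡-Reasoning
    swap-factors : ∀ a b c → a ℤ.* (b ℤ.* c) ≡ b ℤ.* (a ℤ.* c)
    swap-factors = solve-∀

  InIm-neg : ∀ {x} → InIm N x → InIm N (λ i → - x i)
  InIm-neg {x} x∈Im = InIm-cong (λ i → ℤP.-1*i≡-i (x i)) (InIm-* (- + 1) x∈Im)

  InIm-∑ : ∀ {l} (x : Fin l → Fin n → ℤ) → (∀ v → InIm N (x v)) → InIm N (λ i → sumℤ (λ v → x v i))
  InIm-∑ {zero}  x x∈Im = InIm-0
  InIm-∑ {suc l} x x∈Im = InIm-+ (x∈Im zero) (InIm-∑ (x ∘ suc) (x∈Im ∘ suc))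

scaledBasis : ∀ {n} → ℕ → Fin n → Fin n → ℤ
scaledBasis k v i = + k ℤ.* δ (+ 1) (+ 0) v i

toℚ-scaledBasis : ∀ {n} k (v i : Fin n) → toℚ (scaledBasis k v i) ≡ toℚ (+ k) ℚ.* δ ℚ.1ℚ ℚ.0ℚ v i
toℚ-scaledBasis k v i = trans (toℚ-* (+ k) _) (cong (toℚ (+ k) ℚ.*_) (toℚ-δ v i))

IsLeastMultipleInIm : ∀ {n} → (Fin n → Fin n → ℤ) → Fin n → ℕ → Set
IsLeastMultipleInIm N v k =
  0 ℕ.< k × InIm N (scaledBasis k v) × (∀ k′ → 0 ℕ.< k′ → InIm N (scaledBasis k′ v) → k ℕ.≤ k′)

toℚ-invertible : ∀ k → 0 ℕ.< k → Σ ℚ λ k⁻¹ → toℚ (+ k) ℚ.* k⁻¹ ≡ ℚ.1ℚ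
toℚ-invertible k 0<k = ℚ.1/ toℚ (+ k) , ℚP.*-inverseʳ (toℚ (+ k))
  where
  instance
    k≢0 : ℚ.NonZero (toℚ (+ k))
    k≢0 = ℚ.≢-nonZero λ k≡0 → ℕP.<⇒≢ 0<k (sym (ℤP.+-injective (toℚ-injective k≡0)))

module _ {n} (N : Fin n → Fin n → ℤ) where
  open ℚSum using (_*ᵥ_; _*ₘ_; *ᵥ-assoc; ∑-δ*)
  open ≡-Reasoning

  *ᵥ-toℚ-image : ∀ (M : Fin n → Fin n → ℚ) → ℚSum.Inverse M (toℚᵐ N) → ∀ y i →
                 (M *ᵥ toℚ ∘ (N ℤSum.*ᵥ y)) i ≡ toℚ (y i)
  *ᵥ-toℚ-image M MN≡I y i = begin
    (M *ᵥ toℚ ∘ (N ℤSum.*ᵥ y)) i         ≡⟨ ℚSum.∑-cong (λ j → cong (M i j ℚ.*_) (toℚ-*ᵥ N y j)) ⟩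
    (M *ᵥ toℚᵐ N *ᵥ toℚ ∘ y) i          ≡⟨ *ᵥ-assoc M (toℚᵐ N) (toℚ ∘ y) i ⟩
    ((M *ₘ toℚᵐ N) *ᵥ toℚ ∘ y) i        ≡⟨ ℚSum.∑-cong (λ l → cong (ℚ._* toℚ (y l)) (MN≡I i l)) ⟩
    sumℚ (λ l → δ ℚ.1ℚ ℚ.0ℚ i l ℚ.* toℚ (y l)) ≡⟨ ∑-δ* i (toℚ ∘ y) ⟩
    toℚ (y i)                             ∎

  module RationalInverse (M : Fin n → Fin n → ℚ) (M-inverse : IsInverseℚ N M) where
    private
      NM≡I : ℚSum.Inverse (toℚᵐ N) M
      NM≡I = proj₁ M-inverse
      MN≡I : ℚSum.Inverse M (toℚᵐ N)
      MN≡I = proj₂ M-inverse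

    InIm⇒integral : ∀ {x} → InIm N x → ∀ i → IsIntegral ((M *ᵥ toℚ ∘ x) i)
    InIm⇒integral {x} (y , x≡Ny) i =
      y i , sym (trans (ℚSum.∑-cong (λ j → cong (λ t → M i j ℚ.* toℚ t) (x≡Ny j))) (*ᵥ-toℚ-image M MN≡I y i))

    integral⇒InIm : ∀ x → (∀ i → IsIntegral ((M *ᵥ toℚ ∘ x) i)) → InIm N x
    integral⇒InIm x Mx∈ℤ = y , λ i → toℚ-injective (sym (begin
      toℚ ((N ℤSum.*ᵥ y) i)           ≡⟨ toℚ-*ᵥ N y i ⟩
      (toℚᵐ N *ᵥ toℚ ∘ y) i          ≡⟨ ℚSum.∑-cong (λ j → cong (toℚᵐ N i j ℚ.*_) (proj₂ (Mx∈ℤ j))) ⟩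
      (toℚᵐ N *ᵥ M *ᵥ toℚ ∘ x) i     ≡⟨ *ᵥ-assoc (toℚᵐ N) M (toℚ ∘ x) i ⟩
      ((toℚᵐ N *ₘ M) *ᵥ toℚ ∘ x) i   ≡⟨ ℚSum.∑-cong (λ l → cong (ℚ._* toℚ (x l)) (NM≡I i l)) ⟩
      sumℚ (λ l → δ ℚ.1ℚ ℚ.0ℚ i l ℚ.* toℚ (x l)) ≡⟨ ∑-δ* i (toℚ ∘ x) ⟩
      toℚ (x i)                       ∎))
      where
      y : Fin n → ℤ
      y j = proj₁ (Mx∈ℤ j)

    InIm? : ∀ x → Dec (InIm N x)
    InIm? x with FinP.all? (λ i → integral? ((M *ᵥ toℚ ∘ x) i))
    ... | yes Mx∈ℤ = yes (integral⇒InIm x Mx∈ℤ)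
    ... | no Mx∉ℤ = no (Mx∉ℤ ∘ InIm⇒integral)

    *ᵥ-scaledBasis : ∀ k v i → (M *ᵥ toℚ ∘ scaledBasis k v) i ≡ toℚ (+ k) ℚ.* M i v
    *ᵥ-scaledBasis k v i = begin
      sumℚ (λ j → M i j ℚ.* toℚ (+ k ℤ.* δ (+ 1) (+ 0) v j))
        ≡⟨ ℚSum.∑-cong (λ j → cong (M i j ℚ.*_) (toℚ-scaledBasis k v j)) ⟩
      sumℚ (λ j → M i j ℚ.* (toℚ (+ k) ℚ.* δ ℚ.1ℚ ℚ.0ℚ v j))
        ≡⟨ ℚSum.∑-cong (λ j → regroup (M i j) j) ⟩
      sumℚ (λ j → (toℚ (+ k) ℚ.* M i j) ℚ.* δ ℚ.1ℚ ℚ.0ℚ j v)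
        ≡⟨ ℚSum.∑-*δ v (λ j → toℚ (+ k) ℚ.* M i j) ⟩
      toℚ (+ k) ℚ.* M i v ∎
      where
      regroup : ∀ a j → a ℚ.* (toℚ (+ k) ℚ.* δ ℚ.1ℚ ℚ.0ℚ v j) ≡ (toℚ (+ k) ℚ.* a) ℚ.* δ ℚ.1ℚ ℚ.0ℚ j v
      regroup a j = trans (sym (ℚP.*-assoc a (toℚ (+ k)) _))
        (cong₂ ℚ._*_ (ℚP.*-comm a (toℚ (+ k))) (δ-sym {a = ℚ.1ℚ} {b = ℚ.0ℚ} v j))

    InIm-scaledBasis⇒↧ₙ∣ : ∀ k v → InIm N (scaledBasis k v) → ∀ i → ↧ₙ (M i v) ∣ k
    InIm-scaledBasis⇒↧ₙ∣ k v ke∈Im i =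
      let (z , z≡) = InIm⇒integral ke∈Im i in
      integral-multiple⇒↧ₙ∣ k (M i v) (z , trans z≡ (*ᵥ-scaledBasis k v i))

    ↧ₙ∣⇒InIm-scaledBasis : ∀ k v → (∀ i → ↧ₙ (M i v) ∣ k) → InIm N (scaledBasis k v)
    ↧ₙ∣⇒InIm-scaledBasis k v ↧ₙ∣k = integral⇒InIm (scaledBasis k v) λ i →
      let (z , z≡) = ↧ₙ∣⇒integral-multiple k (M i v) (↧ₙ∣k i) in z , trans z≡ (sym (*ᵥ-scaledBasis k v i))

    lcmDenCol-least : ∀ v → (Σ ℕ λ k → 0 ℕ.< k × InIm N (scaledBasis k v)) →
                      IsLeastMultipleInIm N v (lcmDenCol M v)
    lcmDenCol-least v (k , 0<k , ke∈Im) = 0<lcm , ↧ₙ∣⇒InIm-scaledBasis _ v (∣lcmℕ den) , least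
      where
      den : Fin n → ℕ
      den i = ↧ₙ (M i v)
      lcm∣ : ∀ {k′} → InIm N (scaledBasis k′ v) → lcmDenCol M v ∣ k′
      lcm∣ k′e∈Im = lcmℕ-least den (InIm-scaledBasis⇒↧ₙ∣ _ v k′e∈Im)
      0<lcm : 0 ℕ.< lcmDenCol M v
      0<lcm = ℕP.n≢0⇒n>0 λ lcm≡0 → ℕP.<⇒≢ 0<k (sym (0∣⇒≡0 (subst (_∣ k) lcm≡0 (lcm∣ ke∈Im))))
      least : ∀ k′ → 0 ℕ.< k′ → InIm N (scaledBasis k′ v) → lcmDenCol M v ℕ.≤ k′
      least k′ 0<k′ k′e∈Im = ∣⇒≤ {{ℕ.>-nonZero 0<k′}} (lcm∣ k′e∈Im)

  module _ (N-sym : ∀ i j → N i j ≡ N j i) (multiple : ∀ v → Σ ℕ λ k → 0 ℕ.< k × InIm N (scaledBasis k v)) where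

    rationalInverse : Σ (Fin n → Fin n → ℚ) (IsInverseℚ N)
    rationalInverse = M , NM≡I , ℚSum.symmetric-inverseʳ⇒inverseˡ (toℚᵐ N) M (λ i j → cong toℚ (N-sym i j)) NM≡I
      where
      k : Fin n → ℕ
      k v = proj₁ (multiple v)
      y : Fin n → Fin n → ℤ
      y v = proj₁ (proj₂ (proj₂ (multiple v)))
      ke≡Ny : ∀ v i → scaledBasis (k v) v i ≡ (N ℤSum.*ᵥ y v) i
      ke≡Ny v = proj₂ (proj₂ (proj₂ (multiple v)))
      k⁻¹ : Fin n → ℚ
      k⁻¹ v = proj₁ (toℚ-invertible (k v) (proj₁ (proj₂ (multiple v))))
      k*k⁻¹≡1 : ∀ v → toℚ (+ k v) ℚ.* k⁻¹ v ≡ ℚ.1ℚ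
      k*k⁻¹≡1 v = proj₂ (toℚ-invertible (k v) (proj₁ (proj₂ (multiple v))))
      -- Column v of N⁻¹ is y / k whenever N y = k eᵥ.
      M : Fin n → Fin n → ℚ
      M i v = toℚ (y v i) ℚ.* k⁻¹ v
      NM≡I : ℚSum.Inverse (toℚᵐ N) M
      NM≡I i v = begin
        sumℚ (λ j → toℚᵐ N i j ℚ.* (toℚ (y v j) ℚ.* k⁻¹ v))
          ≡⟨ ℚSum.∑-cong (λ j → sym (ℚP.*-assoc (toℚᵐ N i j) _ _)) ⟩
        sumℚ (λ j → (toℚᵐ N i j ℚ.* toℚ (y v j)) ℚ.* k⁻¹ v)
          ≡⟨ ℚSum.∑-*ʳ (k⁻¹ v) (λ j → toℚᵐ N i j ℚ.* toℚ (y v j)) ⟩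
        (toℚᵐ N *ᵥ toℚ ∘ y v) i ℚ.* k⁻¹ v
          ≡⟨ cong (ℚ._* k⁻¹ v) (trans (cong toℚ (ke≡Ny v i)) (toℚ-*ᵥ N (y v) i)) ⟨
        toℚ (scaledBasis (k v) v i) ℚ.* k⁻¹ v
          ≡⟨ cong (ℚ._* k⁻¹ v) (trans (toℚ-scaledBasis (k v) v i) (ℚP.*-comm (toℚ (+ k v)) _)) ⟩
        δ ℚ.1ℚ ℚ.0ℚ v i ℚ.* toℚ (+ k v) ℚ.* k⁻¹ v
          ≡⟨ ℚP.*-assoc (δ ℚ.1ℚ ℚ.0ℚ v i) _ _ ⟩
        δ ℚ.1ℚ ℚ.0ℚ v i ℚ.* (toℚ (+ k v) ℚ.* k⁻¹ v)
          ≡⟨ cong (δ ℚ.1ℚ ℚ.0ℚ v i ℚ.*_) (k*k⁻¹≡1 v) ⟩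
        δ ℚ.1ℚ ℚ.0ℚ v i ℚ.* ℚ.1ℚ
          ≡⟨ trans (ℚP.*-identityʳ _) (δ-sym v i) ⟩
        δ ℚ.1ℚ ℚ.0ℚ i v                                         ∎

inject₁-fromℕ-elim : ∀ {m} (P : Fin (suc m) → Set) → (∀ i → P (inject₁ i)) → P (fromℕ m) → ∀ v → P v
inject₁-fromℕ-elim {zero}  P P-inject₁ P-last zero    = P-last
inject₁-fromℕ-elim {suc m} P P-inject₁ P-last zero    = P-inject₁ zero
inject₁-fromℕ-elim {suc m} P P-inject₁ P-last (suc v) = inject₁-fromℕ-elim (P ∘ suc) (P-inject₁ ∘ suc) P-last v

infixl 5 _∷ʳ_

_∷ʳ_ : ∀ {A : Set} {m} → (Fin m → A) → A → Fin (suc m) → A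
_∷ʳ_ {m = zero}  x c _       = c
_∷ʳ_ {m = suc m} x c zero    = x zero
_∷ʳ_ {m = suc m} x c (suc i) = (x ∘ suc ∷ʳ c) i

∷ʳ-inject₁ : ∀ {A : Set} {m} (x : Fin m → A) c i → (x ∷ʳ c) (inject₁ i) ≡ x i
∷ʳ-inject₁ {m = suc m} x c zero    = refl
∷ʳ-inject₁ {m = suc m} x c (suc i) = ∷ʳ-inject₁ (x ∘ suc) c i

∷ʳ-fromℕ : ∀ {A : Set} {m} (x : Fin m → A) c → (x ∷ʳ c) (fromℕ m) ≡ c
∷ʳ-fromℕ {m = zero}  x c = refl
∷ʳ-fromℕ {m = suc m} x c = ∷ʳ-fromℕ (x ∘ suc) c

degD-split : ∀ {m} (x : Div (suc m)) → degD x ≡ sumℤ (x ∘ inject₁) ℤ.+ x (q m)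
degD-split = ℤSum.∑-init-last

degD-∷ʳ : ∀ {m} (x : Fin m → ℤ) c → degD (x ∷ʳ c) ≡ sumℤ x ℤ.+ c
degD-∷ʳ x c = trans (degD-split (x ∷ʳ c)) (cong₂ ℤ._+_ (ℤSum.∑-cong (∷ʳ-inject₁ x c)) (∷ʳ-fromℕ x c))

resDeg-inject₁ : ∀ {m} (E : Div (suc m)) i → resDeg E (inject₁ i) ≡ E (inject₁ i)
resDeg-inject₁ {m} E i with inject₁ i Fin.≟ q m
... | yes i≡q = contradiction (sym i≡q) FinP.fromℕ≢inject₁
... | no _    = refl

resDeg-q : ∀ {m} (E : Div (suc m)) → resDeg E (q m) ≡ degD E
resDeg-q {m} E with q m Fin.≟ q m
... | yes _  = refl
... | no q≢q = contradiction refl q≢q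

orderVector : ∀ {m} → ℕ → Fin (suc m) → Div (suc m)
orderVector {m} k v w = + k ℤ.* (vtx v w ℤ.- vtx (q m) w)

degD-vtx : ∀ {n} (v : Fin n) → degD (vtx v) ≡ + 1
degD-vtx v = ℤSum.∑-δ v (λ _ → + 1)

degD-orderVector : ∀ {m} k (v : Fin (suc m)) → degD (orderVector k v) ≡ + 0
degD-orderVector {m} k v = begin
  sumℤ (λ w → + k ℤ.* (vtx v w ℤ.- vtx (q m) w))
    ≡⟨ ℤSum.∑-*ˡ (+ k) (λ w → vtx v w ℤ.- vtx (q m) w) ⟩
  + k ℤ.* sumℤ (λ w → vtx v w ℤ.- vtx (q m) w)
    ≡⟨ cong (+ k ℤ.*_) (∑-- (vtx v) (vtx (q m))) ⟩
  + k ℤ.* (degD (vtx v) ℤ.- degD (vtx (q m)))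
    ≡⟨ cong₂ (λ a b → + k ℤ.* (a ℤ.- b)) (degD-vtx v) (degD-vtx (q m)) ⟩
  + k ℤ.* + 0
    ≡⟨ ℤP.*-zeroʳ (+ k) ⟩
  + 0                                             ∎
  where open ≡-Reasoning

orderVector-inject₁ : ∀ {m} k (v i : Fin m) → orderVector k (inject₁ v) (inject₁ i) ≡ scaledBasis k v i
orderVector-inject₁ k v i =
  cong (+ k ℤ.*_) (trans (cong₂ ℤ._-_ (δ-inject₁ v i) (δ-fromℕ-inject₁ i)) (ℤP.+-identityʳ _))

module Laplacian {m : ℕ} (A : Adj (suc m)) where
  open Image (Lred A) using (InIm-cong)
  open ℤSum using (_*ᵥ_; ∑-cong; ∑-+; ∑-*ʳ)
  open ≡-Reasoning

  Lap-row-sum : ∀ i → sumℤ (Lap A i) ≡ + 0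
  Lap-row-sum i = begin
    sumℤ (λ j → δ (+ vdeg A i) (+ 0) i j ℤ.- + A i j)
      ≡⟨ ∑-- (λ j → δ (+ vdeg A i) (+ 0) i j) (λ j → + A i j) ⟩
    sumℤ (λ j → δ (+ vdeg A i) (+ 0) i j) ℤ.- sumℤ (λ j → + A i j)
      ≡⟨ cong₂ ℤ._-_ (ℤSum.∑-δ i (λ _ → + vdeg A i)) (sym (∑-pos (A i))) ⟩
    + vdeg A i ℤ.- + vdeg A i
      ≡⟨ ℤP.+-inverseʳ (+ vdeg A i) ⟩
    + 0                                                              ∎

  Lap-*ᵥ-shift : ∀ z c i → (Lap A *ᵥ (λ j → z j ℤ.- c)) i ≡ (Lap A *ᵥ z) i
  Lap-*ᵥ-shift z c i = begin
    sumℤ (λ j → Lap A i j ℤ.* (z j ℤ.- c))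
      ≡⟨ ∑-cong (λ j → ℤP.*-distribˡ-+ (Lap A i j) (z j) (- c)) ⟩
    sumℤ (λ j → Lap A i j ℤ.* z j ℤ.+ Lap A i j ℤ.* - c)
      ≡⟨ ∑-+ (λ j → Lap A i j ℤ.* z j) (λ j → Lap A i j ℤ.* - c) ⟩
    (Lap A *ᵥ z) i ℤ.+ sumℤ (λ j → Lap A i j ℤ.* - c)
      ≡⟨ cong (ℤ._+_ ((Lap A *ᵥ z) i)) (∑-*ʳ (- c) (Lap A i)) ⟩
    (Lap A *ᵥ z) i ℤ.+ sumℤ (Lap A i) ℤ.* - c
      ≡⟨ cong (λ s → (Lap A *ᵥ z) i ℤ.+ s ℤ.* - c) (Lap-row-sum i) ⟩
    (Lap A *ᵥ z) i ℤ.+ + 0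
      ≡⟨ ℤP.+-identityʳ _ ⟩
    (Lap A *ᵥ z) i                                            ∎

  Lap-*ᵥ-inject₁ : ∀ z → z (q m) ≡ + 0 → ∀ i → (Lap A *ᵥ z) (inject₁ i) ≡ (Lred A *ᵥ z ∘ inject₁) i
  Lap-*ᵥ-inject₁ z zq≡0 i = begin
    (Lap A *ᵥ z) (inject₁ i)
      ≡⟨ ℤSum.∑-init-last (λ j → Lap A (inject₁ i) j ℤ.* z j) ⟩
    (Lred A *ᵥ z ∘ inject₁) i ℤ.+ Lap A (inject₁ i) (q m) ℤ.* z (q m)
      ≡⟨ cong (λ t → (Lred A *ᵥ z ∘ inject₁) i ℤ.+ Lap A (inject₁ i) (q m) ℤ.* t) zq≡0 ⟩
    (Lred A *ᵥ z ∘ inject₁) i ℤ.+ Lap A (inject₁ i) (q m) ℤ.* + 0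
      ≡⟨ cong (ℤ._+_ ((Lred A *ᵥ z ∘ inject₁) i)) (ℤP.*-zeroʳ (Lap A (inject₁ i) (q m))) ⟩
    (Lred A *ᵥ z ∘ inject₁) i ℤ.+ + 0
      ≡⟨ ℤP.+-identityʳ _ ⟩
    (Lred A *ᵥ z ∘ inject₁) i                                         ∎

  InImL⇒InIm-Lred : ∀ {x} → InImL A x → InIm (Lred A) (x ∘ inject₁)
  InImL⇒InIm-Lred (z , x≡Lz) = z′ ∘ inject₁ , λ i → begin
    _                              ≡⟨ x≡Lz (inject₁ i) ⟩
    (Lap A *ᵥ z) (inject₁ i)       ≡⟨ Lap-*ᵥ-shift z (z (q m)) (inject₁ i) ⟨
    (Lap A *ᵥ z′) (inject₁ i)      ≡⟨ Lap-*ᵥ-inject₁ z′ (ℤP.+-inverseʳ (z (q m))) i ⟩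
    (Lred A *ᵥ z′ ∘ inject₁) i     ∎
    where
    z′ : Div (suc m)
    z′ j = z j ℤ.- z (q m)

  InImL⇒InIm-scaledBasis : ∀ k v → InImL A (orderVector k (inject₁ v)) → InIm (Lred A) (scaledBasis k v)
  InImL⇒InIm-scaledBasis k v k[v-q]∈Im = InIm-cong (orderVector-inject₁ k v) (InImL⇒InIm-Lred k[v-q]∈Im)

  IsOrd⇒InIm-scaledBasis : ∀ v {k} → IsOrd A (inject₁ v) k → 0 ℕ.< k × InIm (Lred A) (scaledBasis k v)
  IsOrd⇒InIm-scaledBasis v {k} (0<k , k[v-q]∈Im , _) = 0<k , InImL⇒InIm-scaledBasis k v k[v-q]∈Im

module SymmetricLaplacian {m : ℕ} (A : Adj (suc m)) (A-sym : Symmetric A) where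
  open Laplacian A
  open Image (Lred A) using (InIm-cong)
  open ℤSum using (_*ᵥ_; ∑-cong; ∑-*ʳ; ∑-swap; ∑-zero)
  open ≡-Reasoning

  Lap-sym : ∀ i j → Lap A i j ≡ Lap A j i
  Lap-sym i j = cong₂ ℤ._-_ (diagonal-sym (i Fin.≟ j)) (cong +_ (A-sym i j))
    where
    diagonal-sym : Dec (i ≡ j) → δ (+ vdeg A i) (+ 0) i j ≡ δ (+ vdeg A j) (+ 0) j i
    diagonal-sym (yes refl) = refl
    diagonal-sym (no i≢j)   = trans (δ-≢ i≢j) (sym (δ-≢ (i≢j ∘ sym)))

  Lred-sym : ∀ i j → Lred A i j ≡ Lred A j i
  Lred-sym i j = Lap-sym (inject₁ i) (inject₁ j)

  degD-Lap-*ᵥ : ∀ z → degD (Lap A *ᵥ z) ≡ + 0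
  degD-Lap-*ᵥ z = begin
    sumℤ (λ i → sumℤ (λ j → Lap A i j ℤ.* z j))
      ≡⟨ ∑-swap (λ i j → Lap A i j ℤ.* z j) ⟩
    sumℤ (λ j → sumℤ (λ i → Lap A i j ℤ.* z j))
      ≡⟨ ∑-cong (λ j → ∑-*ʳ (z j) (λ i → Lap A i j)) ⟩
    sumℤ (λ j → sumℤ (λ i → Lap A i j) ℤ.* z j)
      ≡⟨ ∑-cong (λ j → cong (ℤ._* z j) (trans (∑-cong (λ i → Lap-sym i j)) (Lap-row-sum j))) ⟩
    sumℤ (λ j → + 0 ℤ.* z j)
      ≡⟨ ∑-cong (λ j → ℤP.*-zeroˡ (z j)) ⟩
    sumℤ {suc m} (λ _ → + 0)
      ≡⟨ ∑-zero {suc m} ⟩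
    + 0                                          ∎

  InIm-Lred⇒InImL : ∀ {x} → degD x ≡ + 0 → InIm (Lred A) (x ∘ inject₁) → InImL A x
  InIm-Lred⇒InImL {x} deg≡0 (y , x≡L̃y) = z , inject₁-fromℕ-elim _ agree-inject₁ agree-q
    where
    z : Div (suc m)
    z = y ∷ʳ + 0
    agree-inject₁ : ∀ i → x (inject₁ i) ≡ (Lap A *ᵥ z) (inject₁ i)
    agree-inject₁ i = begin
      x (inject₁ i)             ≡⟨ x≡L̃y i ⟩
      (Lred A *ᵥ y) i           ≡⟨ ∑-cong (λ j → cong (Lred A i j ℤ.*_) (∷ʳ-inject₁ y (+ 0) j)) ⟨
      (Lred A *ᵥ z ∘ inject₁) i ≡⟨ Lap-*ᵥ-inject₁ z (∷ʳ-fromℕ y (+ 0)) i ⟨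
      (Lap A *ᵥ z) (inject₁ i)  ∎
    agree-q : x (q m) ≡ (Lap A *ᵥ z) (q m)
    agree-q = +-cancelˡ (sumℤ (x ∘ inject₁)) _ _ (begin
      sumℤ (x ∘ inject₁) ℤ.+ x (q m)
        ≡⟨ degD-split x ⟨
      degD x
        ≡⟨ trans deg≡0 (sym (degD-Lap-*ᵥ z)) ⟩
      degD (Lap A *ᵥ z)
        ≡⟨ degD-split (Lap A *ᵥ z) ⟩
      sumℤ ((Lap A *ᵥ z) ∘ inject₁) ℤ.+ (Lap A *ᵥ z) (q m)
        ≡⟨ cong (ℤ._+ (Lap A *ᵥ z) (q m)) (ℤSum.∑-cong agree-inject₁) ⟨
      sumℤ (x ∘ inject₁) ℤ.+ (Lap A *ᵥ z) (q m)            ∎)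

  InIm-scaledBasis⇒InImL : ∀ k v → InIm (Lred A) (scaledBasis k v) → InImL A (orderVector k (inject₁ v))
  InIm-scaledBasis⇒InImL k v ke∈Im =
    InIm-Lred⇒InImL (degD-orderVector k (inject₁ v)) (InIm-cong (λ i → sym (orderVector-inject₁ k v i)) ke∈Im)

  IsLeastMultipleInIm⇒IsOrd : ∀ v k → IsLeastMultipleInIm (Lred A) v k → IsOrd A (inject₁ v) k
  IsLeastMultipleInIm⇒IsOrd v k (0<k , ke∈Im , least) =
    0<k , InIm-scaledBasis⇒InImL k v ke∈Im , λ k′ 0<k′ → least k′ 0<k′ ∘ InImL⇒InIm-scaledBasis k′ v

i+[j-i]≡j : ∀ i j → i ℤ.+ (j ℤ.- i) ≡ j
i+[j-i]≡j = solve-∀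

[i+j]-i≡j : ∀ i j → (i ℤ.+ j) ℤ.- i ≡ j
[i+j]-i≡j = solve-∀

infix 4 _≡_mod_
infixl 7 _%_

-- A record rather than a synonym for the divisibility, so that a, b and n are recoverable by unification.
record _≡_mod_ (a b : ℤ) (n : ℕ) : Set where
  constructor ≡mod
  field ∣-difference : + n ℤDiv.∣ (a ℤ.- b)

open _≡_mod_ using (∣-difference)

module _ {n : ℕ} where

  private
    via-signed : ∀ {a b x} → x ≡ a ℤ.- b → + n Sg.∣ x → a ≡ b mod n
    via-signed eq n∣x = ≡mod (Sg.∣⇒∣ᵤ (subst (+ n Sg.∣_) eq n∣x))

    signed : ∀ {a b} → a ≡ b mod n → + n Sg.∣ (a ℤ.- b)
    signed = Sg.∣ᵤ⇒∣ ∘ ∣-difference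

  ≡⇒≡-mod : ∀ {a b} → a ≡ b → a ≡ b mod n
  ≡⇒≡-mod {a} refl = via-signed (sym (ℤP.+-inverseʳ a)) (Sg.divides (+ 0) refl)

  ≡-mod-sym : ∀ {a b} → a ≡ b mod n → b ≡ a mod n
  ≡-mod-sym {a} {b} a≡b = via-signed (negate-difference a b) (Sg.∣m⇒∣-m (signed a≡b))
    where
    negate-difference : ∀ a b → - (a ℤ.- b) ≡ b ℤ.- a
    negate-difference = solve-∀

  ≡-mod-trans : ∀ {a b c} → a ≡ b mod n → b ≡ c mod n → a ≡ c mod n
  ≡-mod-trans {a} {b} {c} a≡b b≡c =
    via-signed (ℤP.+-minus-telescope a b c) (Sg.∣m∣n⇒∣m+n (signed a≡b) (signed b≡c))

  +-cong-mod : ∀ {a b c d} → a ≡ b mod n → c ≡ d mod n → a ℤ.+ c ≡ b ℤ.+ d mod n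
  +-cong-mod {a} {b} {c} {d} a≡b c≡d = via-signed (interchange a b c d) (Sg.∣m∣n⇒∣m+n (signed a≡b) (signed c≡d))
    where
    interchange : ∀ a b c d → (a ℤ.- b) ℤ.+ (c ℤ.- d) ≡ (a ℤ.+ c) ℤ.- (b ℤ.+ d)
    interchange = solve-∀

  neg-cong-mod : ∀ {a b} → a ≡ b mod n → - a ≡ - b mod n
  neg-cong-mod {a} {b} a≡b = via-signed (negate-both a b) (Sg.∣m⇒∣-m (signed a≡b))
    where
    negate-both : ∀ a b → - (a ℤ.- b) ≡ - a ℤ.- - b
    negate-both = solve-∀

  +-multiple-≡-mod : ∀ a t → a ℤ.+ t ℤ.* + n ≡ a mod n
  +-multiple-≡-mod a t = via-signed (sym ([i+j]-i≡j a (t ℤ.* + n))) (Sg.divides t refl)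

  ≡-mod⇒quotient : ∀ {a} → a ≡ + 0 mod n → Σ ℤ λ t → a ≡ t ℤ.* + n
  ≡-mod⇒quotient {a} a≡0 with signed a≡0
  ... | Sg.divides t a-0≡tn = t , trans (sym (ℤP.+-identityʳ a)) a-0≡tn

  +-cancelˡ-mod : ∀ {z a b} → z ℤ.+ a ≡ z ℤ.+ b mod n → a ≡ b mod n
  +-cancelˡ-mod {z} {a} {b} z+a≡z+b =
    subst₂ (_≡_mod n) (cancel z a) (cancel z b) (+-cong-mod (≡⇒≡-mod {a = - z} refl) z+a≡z+b)
    where
    cancel : ∀ z a → - z ℤ.+ (z ℤ.+ a) ≡ a
    cancel = solve-∀

  -‿cancelʳ-mod : ∀ {z a b} → a ℤ.- z ≡ b ℤ.- z mod n → a ≡ b mod n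
  -‿cancelʳ-mod {z} {a} {b} a-z≡b-z =
    subst₂ (_≡_mod n) (cancel z a) (cancel z b) (+-cong-mod a-z≡b-z (≡⇒≡-mod {a = z} refl))
    where
    cancel : ∀ z a → (a ℤ.- z) ℤ.+ z ≡ a
    cancel = solve-∀

  ≡-mod-bounded⇒≡ : ∀ {a b} → + 0 ℤ.≤ a → a ℤ.< + n → + 0 ℤ.≤ b → b ℤ.< + n → a ≡ b mod n → a ≡ b
  ≡-mod-bounded⇒≡ {+ a} {+ b} _ (+<+ a<n) _ (+<+ b<n) a≡b =
    ℤP.i-j≡0⇒i≡j (+ a) (+ b) (trans (ℤP.m-n≡m⊖n a b) (ℤP.∣i∣≡0⇒i≡0 (bounded-multiple≡0 n∣∣a⊖b∣)))
    where
    n∣∣a⊖b∣ : n ∣ ℤ.∣ a ℤ.⊖ b ∣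
    n∣∣a⊖b∣ = subst (λ t → n ∣ ℤ.∣ t ∣) (ℤP.m-n≡m⊖n a b) (∣-difference a≡b)
    bounded-multiple≡0 : n ∣ ℤ.∣ a ℤ.⊖ b ∣ → ℤ.∣ a ℤ.⊖ b ∣ ≡ 0
    bounded-multiple≡0 n∣d with ℤ.∣ a ℤ.⊖ b ∣ | ℕP.≤-<-trans (ℤP.∣m⊝n∣≤m⊔n a b) (ℕP.⊔-lub a<n b<n)
    ... | zero  | _   = refl
    ... | suc d | d<n = contradiction n∣d (>⇒∤ d<n)

_%_ : ℤ → (n : ℕ) → .{{NonZero n}} → ℤ
a % n = + (a %ℕ n)

module _ (n : ℕ) .{{_ : NonZero n}} where

  %-nonneg : ∀ a → + 0 ℤ.≤ a % n
  %-nonneg a = +≤+ ℕ.z≤n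

  %-< : ∀ a → a % n ℤ.< + n
  %-< a = +<+ (n%ℕd<d a n)

  %-≡-mod : ∀ a → a % n ≡ a mod n
  %-≡-mod a = ≡-mod-sym (subst (_≡ a % n mod n) (sym (a≡a%ℕn+[a/ℕn]*n a n)) (+-multiple-≡-mod (a % n) (a /ℕ n)))

  ≡-mod⇒%-≡ : ∀ {a b} → a ≡ b mod n → a % n ≡ b % n
  ≡-mod⇒%-≡ {a} {b} a≡b = ≡-mod-bounded⇒≡ (%-nonneg a) (%-< a) (%-nonneg b) (%-< b)
    (≡-mod-trans (%-≡-mod a) (≡-mod-trans a≡b (≡-mod-sym (%-≡-mod b))))

  %-≡⇒≡-mod : ∀ {a b} → a % n ≡ b % n → a ≡ b mod n
  %-≡⇒≡-mod {a} {b} eq = ≡-mod-trans (≡-mod-sym (%-≡-mod a)) (subst (_≡ b mod n) (sym eq) (%-≡-mod b))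

  %-bounded : ∀ {a} → + 0 ℤ.≤ a → a ℤ.< + n → a % n ≡ a
  %-bounded {a} 0≤a a<n = ≡-mod-bounded⇒≡ (%-nonneg a) (%-< a) 0≤a a<n (%-≡-mod a)

AllNonZero : ∀ {k} → (Fin k → ℕ) → Set
AllNonZero r = ∀ i → NonZero (r i)

decode : ∀ {k} (r : Fin k → ℕ) → Fin (prodℕ r) → Fin k → ℤ
decode r j zero    = + Fin.toℕ (proj₁ (Fin.remQuot {r zero} (prodℕ (r ∘ suc)) j))
decode r j (suc i) = decode (r ∘ suc) (proj₂ (Fin.remQuot {r zero} (prodℕ (r ∘ suc)) j)) i

encode : ∀ {k} (r : Fin k → ℕ) → AllNonZero r → (Fin k → ℤ) → Fin (prodℕ r)
encode {zero}  r r≢0 x = zero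
encode {suc k} r r≢0 x =
  Fin.combine (Fin.fromℕ< (n%ℕd<d (x zero) (r zero) {{r≢0 zero}})) (encode (r ∘ suc) (r≢0 ∘ suc) (x ∘ suc))

decode-encode : ∀ {k} (r : Fin k → ℕ) r≢0 x i → decode r (encode r r≢0 x) i ≡ _%_ (x i) (r i) {{r≢0 i}}
decode-encode r r≢0 x zero = trans
  (cong (λ p → + Fin.toℕ (proj₁ p)) (FinP.remQuot-combine {r zero} {prodℕ (r ∘ suc)} _ _))
  (cong +_ (FinP.toℕ-fromℕ< _))
decode-encode r r≢0 x (suc i) = trans
  (cong (λ p → decode (r ∘ suc) (proj₂ p) i) (FinP.remQuot-combine {r zero} {prodℕ (r ∘ suc)} _ _))
  (decode-encode (r ∘ suc) (r≢0 ∘ suc) (x ∘ suc) i)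

encode-cong : ∀ {k} (r : Fin k → ℕ) r≢0 {x y} →
              (∀ i → _%_ (x i) (r i) {{r≢0 i}} ≡ _%_ (y i) (r i) {{r≢0 i}}) → encode r r≢0 x ≡ encode r r≢0 y
encode-cong {zero}  r r≢0 x%≡y% = refl
encode-cong {suc k} r r≢0 {x} {y} x%≡y% = cong₂ (Fin.combine {r zero} {prodℕ (r ∘ suc)})
  (FinP.toℕ-injective (trans (FinP.toℕ-fromℕ< _) (trans (ℤP.+-injective (x%≡y% zero)) (sym (FinP.toℕ-fromℕ< _)))))
  (encode-cong (r ∘ suc) (r≢0 ∘ suc) {x ∘ suc} {y ∘ suc} (x%≡y% ∘ suc))

encode-decode : ∀ {k} (r : Fin k → ℕ) r≢0 j → encode r r≢0 (decode r j) ≡ j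
encode-decode {zero}  r r≢0 zero = refl
encode-decode {suc k} r r≢0 j = trans
  (cong₂ (Fin.combine {r zero} {prodℕ (r ∘ suc)})
    (FinP.toℕ-injective (trans (FinP.toℕ-fromℕ< _) (ℕDM.m<n⇒m%n≡m {{r≢0 zero}} (FinP.toℕ<n a))))
    (encode-decode (r ∘ suc) (r≢0 ∘ suc) b))
  (FinP.combine-remQuot {r zero} (prodℕ (r ∘ suc)) j)
  where
  a = proj₁ (Fin.remQuot {r zero} (prodℕ (r ∘ suc)) j)
  b = proj₂ (Fin.remQuot {r zero} (prodℕ (r ∘ suc)) j)

infix 4 _≡ᵛ_mod_

_≡ᵛ_mod_ : ∀ {k} → (Fin k → ℤ) → (Fin k → ℤ) → (Fin k → ℕ) → Set
x ≡ᵛ y mod r = ∀ i → x i ≡ y i mod r i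

module _ {k} {r : Fin k → ℕ} where

  ≡ᵛ-mod-refl : ∀ {x} → x ≡ᵛ x mod r
  ≡ᵛ-mod-refl i = ≡⇒≡-mod refl

  ≡ᵛ-mod-sym : ∀ {x y} → x ≡ᵛ y mod r → y ≡ᵛ x mod r
  ≡ᵛ-mod-sym x≡y i = ≡-mod-sym (x≡y i)

  ≡ᵛ-mod-trans : ∀ {x y z} → x ≡ᵛ y mod r → y ≡ᵛ z mod r → x ≡ᵛ z mod r
  ≡ᵛ-mod-trans x≡y y≡z i = ≡-mod-trans (x≡y i) (y≡z i)

  -‿congᵛ-mod : ∀ {x y x′ y′} → x ≡ᵛ y mod r → x′ ≡ᵛ y′ mod r →
                (λ i → x i ℤ.- x′ i) ≡ᵛ (λ i → y i ℤ.- y′ i) mod r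
  -‿congᵛ-mod x≡y x′≡y′ i = +-cong-mod (x≡y i) (neg-cong-mod (x′≡y′ i))

module BoxEncoding {k} (r : Fin k → ℕ) (r≢0 : AllNonZero r) where

  decode-encode-≡ᵛ : ∀ x → decode r (encode r r≢0 x) ≡ᵛ x mod r
  decode-encode-≡ᵛ x i = subst (_≡ x i mod r i) (sym (decode-encode r r≢0 x i)) (%-≡-mod (r i) {{r≢0 i}} (x i))

  encode-≡⇒≡ᵛ : ∀ {x y} → encode r r≢0 x ≡ encode r r≢0 y → x ≡ᵛ y mod r
  encode-≡⇒≡ᵛ {x} {y} eq i = %-≡⇒≡-mod (r i) {{r≢0 i}}
    (trans (sym (decode-encode r r≢0 x i)) (trans (cong (λ j → decode r j i) eq) (decode-encode r r≢0 y i)))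

  ≡ᵛ⇒encode-≡ : ∀ {x y} → x ≡ᵛ y mod r → encode r r≢0 x ≡ encode r r≢0 y
  ≡ᵛ⇒encode-≡ x≡y = encode-cong r r≢0 (λ i → ≡-mod⇒%-≡ (r i) {{r≢0 i}} (x≡y i))

  decode-≡ᵛ⇒≡ : ∀ {j j′} → decode r j ≡ᵛ decode r j′ mod r → j ≡ j′
  decode-≡ᵛ⇒≡ {j} {j′} dj≡dj′ =
    trans (sym (encode-decode r r≢0 j)) (trans (≡ᵛ⇒encode-≡ dj≡dj′) (encode-decode r r≢0 j′))

enumerate : ∀ {n} (Q : Fin n → Set) → (∀ j → Dec (Q j)) → Σ ℕ (HasCard Q _≡_)
enumerate {zero}  Q Q? = 0 , (λ ()) , (λ ()) , (λ ()) , (λ ())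
enumerate {suc n} Q Q? with enumerate (Q ∘ suc) (Q? ∘ suc) | Q? zero
... | c , f , Qf , f-inj , f-onto | yes Q0 = suc c , f′ , Qf′ , f′-inj , f′-onto
  where
  f′ : Fin (suc c) → Fin (suc n)
  f′ zero    = zero
  f′ (suc b) = suc (f b)
  Qf′ : ∀ b → Q (f′ b)
  Qf′ zero    = Q0
  Qf′ (suc b) = Qf b
  f′-inj : ∀ b b′ → f′ b ≡ f′ b′ → b ≡ b′
  f′-inj zero    zero     _  = refl
  f′-inj (suc b) (suc b′) eq = cong suc (f-inj b b′ (FinP.suc-injective eq))
  f′-onto : ∀ j → Q j → Σ (Fin (suc c)) λ b → j ≡ f′ b
  f′-onto zero    _  = zero , refl
  f′-onto (suc j) Qj = let (b , j≡fb) = f-onto j Qj in suc b , cong suc j≡fb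
... | c , f , Qf , f-inj , f-onto | no ¬Q0 =
  c , suc ∘ f , Qf , (λ b b′ eq → f-inj b b′ (FinP.suc-injective eq)) , f′-onto
  where
  f′-onto : ∀ j → Q j → Σ (Fin c) λ b → j ≡ suc (f b)
  f′-onto zero    Q0 = contradiction Q0 ¬Q0
  f′-onto (suc j) Qj = let (b , j≡fb) = f-onto j Qj in b , cong suc j≡fb

Minimal : ∀ {n} → (Fin n → Set) → Fin n → Set
Minimal Q j₀ = Q j₀ × (∀ j → j Fin.< j₀ → ¬ Q j)

minimal : ∀ {n} (Q : Fin n → Set) → (∀ j → Dec (Q j)) → ∀ j → Q j → Σ (Fin n) (Minimal Q)
minimal {suc n} Q Q? j Qj with Q? zero
... | yes Q0 = zero , Q0 , λ _ ()
minimal {suc n} Q Q? zero    Q0 | no ¬Q0 = contradiction Q0 ¬Q0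
minimal {suc n} Q Q? (suc j) Qj | no ¬Q0 with minimal (Q ∘ suc) (Q? ∘ suc) j Qj
... | j₀ , Qj₀ , below = suc j₀ , Qj₀ , below′
  where
  below′ : ∀ j → j Fin.< suc j₀ → ¬ Q j
  below′ zero    _          = ¬Q0
  below′ (suc j) (ℕ.s≤s j<j₀) = below j j<j₀

minimal-unique : ∀ {n} {Q : Fin n → Set} {j₀ j₁} → Minimal Q j₀ → Minimal Q j₁ → j₀ ≡ j₁
minimal-unique {j₀ = j₀} {j₁} (Qj₀ , below₀) (Qj₁ , below₁) with FinP.<-cmp j₀ j₁
... | tri< j₀<j₁ _ _ = contradiction Qj₀ (below₁ j₀ j₀<j₁)
... | tri≈ _ j₀≡j₁ _ = j₀≡j₁
... | tri> _ _ j₁<j₀ = contradiction Qj₁ (below₀ j₁ j₁<j₀)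

bounded⇒Fin : ∀ {n z} → + 0 ℤ.≤ z → z ℤ.< + n → Σ (Fin n) λ a → z ≡ + Fin.toℕ a
bounded⇒Fin {z = + k} _ (+<+ k<n) = Fin.fromℕ< k<n , cong +_ (sym (FinP.toℕ-fromℕ< k<n))

prodℕ-init-last : ∀ {m} (f : Fin (suc m) → ℕ) → prodℕ f ≡ prodℕ (f ∘ inject₁) ℕ.* f (fromℕ m)
prodℕ-init-last {zero}  f = trans (ℕP.*-identityʳ (f zero)) (sym (ℕP.*-identityˡ (f zero)))
prodℕ-init-last {suc m} f = trans (cong (f zero ℕ.*_) (prodℕ-init-last (f ∘ suc))) (sym (ℕP.*-assoc (f zero) _ _))

injections⇒≡ : ∀ {m n} (f : Fin m → Fin n) (g : Fin n → Fin m) →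
               (∀ {x y} → f x ≡ f y → x ≡ y) → (∀ {x y} → g x ≡ g y → x ≡ y) → m ≡ n
injections⇒≡ f g f-inj g-inj = ℕP.≤-antisym (FinP.injective⇒≤ {f = f} f-inj) (FinP.injective⇒≤ {f = g} g-inj)

pairing-injective : ∀ {n a b} (f : Fin n → Fin a × Fin b) → (∀ {x y} → f x ≡ f y → x ≡ y) →
                    ∀ {x y} → Fin.combine {a} {b} (proj₁ (f x)) (proj₂ (f x))
                            ≡ Fin.combine (proj₁ (f y)) (proj₂ (f y)) → x ≡ y
pairing-injective {a = a} {b} f f-inj {x} {y} eq = f-inj (trans (sym (FinP.remQuot-combine {a} {b} _ _))
  (trans (cong (Fin.remQuot b) eq) (FinP.remQuot-combine {a} {b} _ _)))

unpairing-injective : ∀ {a b} {X : Set} (R : X → X → Set) (g : Fin a → Fin b → X) →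
                      (∀ {x x′ y y′} → R (g x y) (g x′ y′) → x ≡ x′ × y ≡ y′) →
                      ∀ {k k′} → R (g (proj₁ (Fin.remQuot {a} b k)) (proj₂ (Fin.remQuot {a} b k)))
                                   (g (proj₁ (Fin.remQuot {a} b k′)) (proj₂ (Fin.remQuot {a} b k′))) → k ≡ k′
unpairing-injective {a} {b} R g g-inj {k} {k′} gk~gk′ = let (x≡x′ , y≡y′) = g-inj gk~gk′ in
  trans (sym (FinP.combine-remQuot {a} b k)) (trans (cong₂ Fin.combine x≡x′ y≡y′) (FinP.combine-remQuot {a} b k′))

module SubgroupIndex {m} (ℓ : Fin m → ℕ) (ℓ≢0 : AllNonZero ℓ)
  (H : (Fin m → ℤ) → Set) (H? : ∀ x → Dec (H x))
  (H-cong : ∀ {x y} → (∀ i → x i ≡ y i) → H x → H y)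
  (H-+ : ∀ {x y} → H x → H y → H (λ i → x i ℤ.+ y i))
  (H-neg : ∀ {x} → H x → H (λ i → - x i))
  (H-multiples : ∀ {x} → x ≡ᵛ (λ _ → + 0) mod ℓ → H x) where

  open BoxEncoding ℓ ℓ≢0

  H-shift : ∀ {x y} → H x → y ≡ᵛ x mod ℓ → H y
  H-shift {x} {y} Hx y≡x = H-cong (λ i → i+[j-i]≡j (x i) (y i)) (H-+ Hx (H-multiples y-x≡0))
    where
    y-x≡0 : (λ i → y i ℤ.- x i) ≡ᵛ (λ _ → + 0) mod ℓ
    y-x≡0 = ≡ᵛ-mod-trans (-‿congᵛ-mod y≡x ≡ᵛ-mod-refl) (λ i → ≡⇒≡-mod (ℤP.+-inverseʳ (x i)))

  B : ℕ
  B = prodℕ ℓ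

  dec : Fin B → Fin m → ℤ
  dec = decode ℓ

  enc : (Fin m → ℤ) → Fin B
  enc = encode ℓ ℓ≢0

  infix 4 _~_

  _~_ : Fin B → Fin B → Set
  j ~ j′ = H (λ i → dec j i ℤ.- dec j′ i)

  ~-refl : ∀ {j} → j ~ j
  ~-refl {j} = H-multiples (λ i → ≡⇒≡-mod (ℤP.+-inverseʳ (dec j i)))

  ~-sym : ∀ {j j′} → j ~ j′ → j′ ~ j
  ~-sym {j} {j′} j~j′ = H-cong (λ i → negate-difference (dec j i) (dec j′ i)) (H-neg j~j′)
    where
    negate-difference : ∀ a b → - (a ℤ.- b) ≡ b ℤ.- a
    negate-difference = solve-∀

  ~-trans : ∀ {j j′ j″} → j ~ j′ → j′ ~ j″ → j ~ j″
  ~-trans {j} {j′} {j″} j~j′ j′~j″ =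
    H-cong (λ i → ℤP.+-minus-telescope (dec j i) (dec j′ i) (dec j″ i)) (H-+ j~j′ j′~j″)

  rep : Fin B → Fin B
  rep j = proj₁ (minimal (_~ j) (λ j′ → H? _) j ~-refl)

  rep-minimal : ∀ j → Minimal (_~ j) (rep j)
  rep-minimal j = proj₂ (minimal (_~ j) (λ j′ → H? _) j ~-refl)

  rep-~ : ∀ j → rep j ~ j
  rep-~ j = proj₁ (rep-minimal j)

  rep-cong : ∀ {j j′} → j ~ j′ → rep j ≡ rep j′
  rep-cong {j} {j′} j~j′ = minimal-unique (rep-minimal j)
    (~-trans (rep-~ j′) (~-sym j~j′) , λ x x<rep x~j → proj₂ (rep-minimal j′) x x<rep (~-trans x~j j~j′))

  IsRep : Fin B → Set
  IsRep j = rep j ≡ j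

  rep-IsRep : ∀ j → IsRep (rep j)
  rep-IsRep j = rep-cong (rep-~ j)

  IsRep-~⇒≡ : ∀ {j j′} → IsRep j → IsRep j′ → j ~ j′ → j ≡ j′
  IsRep-~⇒≡ {j} {j′} rj≡j rj′≡j′ j~j′ = trans (sym rj≡j) (trans (rep-cong j~j′) rj′≡j′)

  reps : Σ ℕ (HasCard IsRep _≡_)
  reps = enumerate IsRep (λ j → rep j Fin.≟ j)

  J : ℕ
  J = proj₁ reps

  repAt : Fin J → Fin B
  repAt = proj₁ (proj₂ reps)

  repAt-IsRep : ∀ a → IsRep (repAt a)
  repAt-IsRep = proj₁ (proj₂ (proj₂ reps))

  repAt-injective : ∀ a a′ → repAt a ≡ repAt a′ → a ≡ a′
  repAt-injective = proj₁ (proj₂ (proj₂ (proj₂ reps)))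

  repAt-onto : ∀ j → IsRep j → Σ (Fin J) λ a → j ≡ repAt a
  repAt-onto = proj₂ (proj₂ (proj₂ (proj₂ reps)))

  subgroup : Σ ℕ (HasCard (H ∘ dec) _≡_)
  subgroup = enumerate (H ∘ dec) (H? ∘ dec)

  c : ℕ
  c = proj₁ subgroup

  elemAt : Fin c → Fin B
  elemAt = proj₁ (proj₂ subgroup)

  elemAt-H : ∀ b → H (dec (elemAt b))
  elemAt-H = proj₁ (proj₂ (proj₂ subgroup))

  elemAt-injective : ∀ b b′ → elemAt b ≡ elemAt b′ → b ≡ b′
  elemAt-injective = proj₁ (proj₂ (proj₂ (proj₂ subgroup)))

  elemAt-onto : ∀ j → H (dec j) → Σ (Fin c) λ b → j ≡ elemAt b
  elemAt-onto = proj₂ (proj₂ (proj₂ (proj₂ subgroup)))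

  glue : Fin J → Fin c → Fin B
  glue a b = enc (λ i → dec (repAt a) i ℤ.+ dec (elemAt b) i)

  rep-glue : ∀ a b → rep (glue a b) ≡ repAt a
  rep-glue a b = trans (sym (rep-cong r~glue)) (repAt-IsRep a)
    where
    r = dec (repAt a)
    t = dec (elemAt b)
    r-glue≡-t : (λ i → r i ℤ.- dec (glue a b) i) ≡ᵛ (λ i → - t i) mod ℓ
    r-glue≡-t i = ≡-mod-trans (-‿congᵛ-mod {x = r} ≡ᵛ-mod-refl (decode-encode-≡ᵛ (λ i → r i ℤ.+ t i)) i)
                              (≡⇒≡-mod (subtract-sum (r i) (t i)))
      where
      subtract-sum : ∀ r t → r ℤ.- (r ℤ.+ t) ≡ - t
      subtract-sum = solve-∀
    r~glue : repAt a ~ glue a b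
    r~glue = H-shift (H-neg (elemAt-H b)) r-glue≡-t

  glue-injective : ∀ {a a′ b b′} → glue a b ≡ glue a′ b′ → a ≡ a′ × b ≡ b′
  glue-injective {a} {a′} {b} {b′} eq = a≡a′ , elemAt-injective b b′ (decode-≡ᵛ⇒≡ t≡t′)
    where
    a≡a′ : a ≡ a′
    a≡a′ = repAt-injective a a′ (trans (sym (rep-glue a b)) (trans (cong rep eq) (rep-glue a′ b′)))
    t≡t′ : dec (elemAt b) ≡ᵛ dec (elemAt b′) mod ℓ
    t≡t′ i = +-cancelˡ-mod {z = dec (repAt a) i}
      (subst (λ a″ → _ ≡ dec (repAt a″) i ℤ.+ _ mod ℓ i) (sym a≡a′) (encode-≡⇒≡ᵛ eq i))

  offset : Fin B → Fin B
  offset x = enc (λ i → dec x i ℤ.- dec (rep x) i)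

  offset-H : ∀ x → H (dec (offset x))
  offset-H x = H-shift (~-sym (rep-~ x)) (decode-encode-≡ᵛ _)

  split : Fin B → Fin J × Fin c
  split x = proj₁ (repAt-onto (rep x) (rep-IsRep x)) , proj₁ (elemAt-onto (offset x) (offset-H x))

  split-injective : ∀ {x y} → split x ≡ split y → x ≡ y
  split-injective {x} {y} eq = decode-≡ᵛ⇒≡ λ i →
    -‿cancelʳ-mod (subst (λ z → dec x i ℤ.- dec (rep x) i ≡ dec y i ℤ.- dec z i mod ℓ i)
                         (sym rx≡ry) (encode-≡⇒≡ᵛ ox≡oy i))
    where
    rx≡ry : rep x ≡ rep y
    rx≡ry = trans (proj₂ (repAt-onto (rep x) (rep-IsRep x)))
              (trans (cong (repAt ∘ proj₁) eq) (sym (proj₂ (repAt-onto (rep y) (rep-IsRep y)))))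
    ox≡oy : offset x ≡ offset y
    ox≡oy = trans (proj₂ (elemAt-onto (offset x) (offset-H x)))
              (trans (cong (elemAt ∘ proj₂) eq) (sym (proj₂ (elemAt-onto (offset y) (offset-H y)))))

  -- Lagrange: modulo ℓ, each box element is uniquely a class representative plus an element of H.
  index-count : B ≡ J ℕ.* c
  index-count = injections⇒≡
    (λ x → Fin.combine (proj₁ (split x)) (proj₂ (split x)))
    (λ k → glue (proj₁ (Fin.remQuot {J} c k)) (proj₂ (Fin.remQuot {J} c k)))
    (pairing-injective split split-injective)
    (unpairing-injective _≡_ glue glue-injective)

module StandardRepresentatives {m} (A : Adj (suc m)) (A-sym : Symmetric A)
  (ℓ : Fin (suc m) → ℕ) (ℓ-mult : ∀ v → PosMultOfOrd A v (ℓ v)) where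
  open Laplacian A
  open SymmetricLaplacian A A-sym
  open Image (Lred A)

  ord-multiple : ∀ v → Σ ℕ λ k → 0 ℕ.< k × InIm (Lred A) (scaledBasis k v)
  ord-multiple v = let (k , ord , _) = ℓ-mult (inject₁ v) in k , IsOrd⇒InIm-scaledBasis v ord

  ℓ≢0 : AllNonZero ℓ
  ℓ≢0 v = ℕ.>-nonZero (proj₁ (proj₂ (proj₂ (ℓ-mult v))))

  ℓ′ : Fin m → ℕ
  ℓ′ = ℓ ∘ inject₁

  InIm-scaledBasis-ℓ : ∀ v → InIm (Lred A) (scaledBasis (ℓ′ v) v)
  InIm-scaledBasis-ℓ v with ℓ-mult (inject₁ v)
  ... | k , ord , _ , divides t ℓ≡tk =
    InIm-cong regroup (InIm-* (+ t) (proj₂ (IsOrd⇒InIm-scaledBasis v ord)))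
    where
    regroup : ∀ i → + t ℤ.* scaledBasis k v i ≡ scaledBasis (ℓ′ v) v i
    regroup i = trans (sym (ℤP.*-assoc (+ t) (+ k) _))
      (cong (ℤ._* δ (+ 1) (+ 0) v i) (trans (sym (ℤP.pos-* t k)) (cong +_ (sym ℓ≡tk))))

  ≡ᵛ0⇒InIm : ∀ {x} → x ≡ᵛ (λ _ → + 0) mod ℓ′ → InIm (Lred A) x
  ≡ᵛ0⇒InIm {x} x≡0 =
    InIm-cong x≡∑ (InIm-∑ (λ v i → t v ℤ.* scaledBasis (ℓ′ v) v i) (λ v → InIm-* (t v) (InIm-scaledBasis-ℓ v)))
    where
    t : Fin m → ℤ
    t v = proj₁ (≡-mod⇒quotient (x≡0 v))
    x≡∑ : ∀ i → sumℤ (λ v → t v ℤ.* scaledBasis (ℓ′ v) v i) ≡ x i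
    x≡∑ i = trans (ℤSum.∑-cong (λ v → sym (ℤP.*-assoc (t v) (+ ℓ′ v) _)))
      (trans (ℤSum.∑-*δ i (λ v → t v ℤ.* + ℓ′ v)) (sym (proj₂ (≡-mod⇒quotient (x≡0 i)))))

  Lred⁻¹ : Σ (Fin m → Fin m → ℚ) (IsInverseℚ (Lred A))
  Lred⁻¹ = rationalInverse (Lred A) Lred-sym ord-multiple

  open SubgroupIndex ℓ′ (ℓ≢0 ∘ inject₁) (InIm (Lred A))
    (RationalInverse.InIm? (Lred A) (proj₁ Lred⁻¹) (proj₂ Lred⁻¹))
    InIm-cong InIm-+ InIm-neg ≡ᵛ0⇒InIm

  D+kq-inject₁ : ∀ (D : Div (suc m)) k i → D (inject₁ i) ℤ.+ + k ℤ.* vtx (q m) (inject₁ i) ≡ D (inject₁ i)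
  D+kq-inject₁ D k i = trans (cong (λ t → D (inject₁ i) ℤ.+ + k ℤ.* t) (δ-fromℕ-inject₁ i))
    (trans (cong (ℤ._+_ (D (inject₁ i))) (ℤP.*-zeroʳ (+ k))) (ℤP.+-identityʳ _))

  InS⇒InIm : ∀ {D E} → InS A ℓ D E → InIm (Lred A) (λ i → E (inject₁ i) ℤ.- D (inject₁ i))
  InS⇒InIm {D} {E} ((_ , k , E∼D+kq) , _) =
    InIm-cong (λ i → cong (ℤ._-_ (E (inject₁ i))) (D+kq-inject₁ D k i)) (InImL⇒InIm-Lred E∼D+kq)

  InIm⇒InS : ∀ {D E} → degD D ≡ + 0 → Effective E → (∀ v → E v ℤ.< + ℓ v) →
             InIm (Lred A) (λ i → E (inject₁ i) ℤ.- D (inject₁ i)) → InS A ℓ D E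
  InIm⇒InS {D} {E} degD≡0 E≥0 E<ℓ E-D∈Im =
    (E≥0 , k , InIm-Lred⇒InImL deg≡0 (InIm-cong (λ i → sym (cong (ℤ._-_ (E (inject₁ i))) (D+kq-inject₁ D k i))) E-D∈Im))
    , E<ℓ
    where
    k : ℕ
    k = ℤ.∣ degD E ∣
    deg≡0 : degD (λ v → E v ℤ.- (D v ℤ.+ + k ℤ.* vtx (q m) v)) ≡ + 0
    deg≡0 = begin
      degD (λ v → E v ℤ.- (D v ℤ.+ + k ℤ.* vtx (q m) v))
        ≡⟨ ∑-- E (λ v → D v ℤ.+ + k ℤ.* vtx (q m) v) ⟩
      degD E ℤ.- degD (λ v → D v ℤ.+ + k ℤ.* vtx (q m) v)
        ≡⟨ cong (ℤ._-_ (degD E)) (ℤSum.∑-+ D (λ v → + k ℤ.* vtx (q m) v)) ⟩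
      degD E ℤ.- (degD D ℤ.+ degD (λ v → + k ℤ.* vtx (q m) v))
        ≡⟨ cong (λ t → degD E ℤ.- (degD D ℤ.+ t)) (ℤSum.∑-*ˡ (+ k) (vtx (q m))) ⟩
      degD E ℤ.- (degD D ℤ.+ + k ℤ.* degD (vtx (q m)))
        ≡⟨ cong₂ (λ d t → degD E ℤ.- (d ℤ.+ + k ℤ.* t)) degD≡0 (degD-vtx (q m)) ⟩
      degD E ℤ.- (+ 0 ℤ.+ + k ℤ.* + 1)
        ≡⟨ cong (λ t → degD E ℤ.- t) (trans (ℤP.+-identityˡ _) (trans (ℤP.*-identityʳ (+ k)) (ℤP.0≤i⇒+∣i∣≡i (∑-nonneg E E≥0)))) ⟩
      degD E ℤ.- degD E
        ≡⟨ ℤP.+-inverseʳ (degD E) ⟩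
      + 0                                                    ∎
      where open ≡-Reasoning

  InS⇒InH : ∀ {D E} → InS A ℓ D E → InH A ℓ D (resDeg E)
  InS⇒InH {D} {E} E∈S =
    resDeg E , (y , degD E ℤ.- D (q m) , coset-inject₁ , coset-q) , λ v → ∣-difference (≡⇒≡-mod {a = resDeg E v} refl)
    where
    y = proj₁ (InS⇒InIm {D} {E} E∈S)
    E-D≡L̃y = proj₂ (InS⇒InIm {D} {E} E∈S)
    coset-inject₁ : ∀ i → resDeg E (inject₁ i) ≡ D (inject₁ i) ℤ.+ (Lred A ℤSum.*ᵥ y) i
    coset-inject₁ i = trans (resDeg-inject₁ E i)
      (trans (sym (i+[j-i]≡j (D (inject₁ i)) (E (inject₁ i)))) (cong (ℤ._+_ (D (inject₁ i))) (E-D≡L̃y i)))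
    coset-q : resDeg E (q m) ≡ D (q m) ℤ.+ (degD E ℤ.- D (q m))
    coset-q = trans (resDeg-q E) (sym (i+[j-i]≡j (D (q m)) (degD E)))

  InS-bounded-≡ : ∀ {D E E′} → InS A ℓ D E → InS A ℓ D E′ → ∀ v → E v ≡ E′ v mod ℓ v → E v ≡ E′ v
  InS-bounded-≡ ((E≥0 , _) , E<ℓ) ((E′≥0 , _) , E′<ℓ) v = ≡-mod-bounded⇒≡ (E≥0 v) (E<ℓ v) (E′≥0 v) (E′<ℓ v)

  InS-unique : ∀ {D E E′} → InS A ℓ D E → InS A ℓ D E′ → ModEq ℓ (resDeg E) (resDeg E′) → PtEq E E′
  InS-unique {D} {E} {E′} E∈S E′∈S rE≡rE′ = inject₁-fromℕ-elim _ agree-inject₁ agree-q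
    where
    agree-inject₁ : ∀ i → E (inject₁ i) ≡ E′ (inject₁ i)
    agree-inject₁ i = InS-bounded-≡ {D} E∈S E′∈S (inject₁ i)
      (subst₂ (_≡_mod ℓ (inject₁ i)) (resDeg-inject₁ E i) (resDeg-inject₁ E′ i) (≡mod (rE≡rE′ (inject₁ i))))
    degE≡degE′ : degD E ≡ degD E′ mod ℓ (q m)
    degE≡degE′ = subst₂ (_≡_mod ℓ (q m)) (resDeg-q E) (resDeg-q E′) (≡mod (rE≡rE′ (q m)))
    agree-q : E (q m) ≡ E′ (q m)
    agree-q = InS-bounded-≡ {D} E∈S E′∈S (q m) (+-cancelˡ-mod {z = sumℤ (E′ ∘ inject₁)}
      (subst₂ (_≡_mod ℓ (q m))
        (trans (degD-split E) (cong (ℤ._+ E (q m)) (ℤSum.∑-cong agree-inject₁))) (degD-split E′) degE≡degE′))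

  private instance
    ℓ-nonZero : ∀ {v} → NonZero (ℓ v)
    ℓ-nonZero {v} = ℓ≢0 v

  InH⇒InS : ∀ {D} → degD D ≡ + 0 → ∀ x → InH A ℓ D x →
            Σ (Div (suc m)) λ E → InS A ℓ D E × ModEq ℓ (resDeg E) x
  InH⇒InS {D} degD≡0 x (w , (y , _ , w≡D+L̃y , _) , x≡w) =
    E , InIm⇒InS {D} {E} degD≡0 E≥0 E<ℓ E-D∈Im , λ v → ∣-difference (E≡x v)
    where
    e : Fin m → ℤ
    e i = x (inject₁ i) % ℓ (inject₁ i)
    -- E(q) is chosen so that deg E ≡ x(q) modulo ℓ_q.
    E : Div (suc m)
    E = e ∷ʳ (x (q m) ℤ.- sumℤ e) % ℓ (q m)
    E≥0 : Effective E
    E≥0 = inject₁-fromℕ-elim _ (λ i → subst (+ 0 ℤ.≤_) (sym (∷ʳ-inject₁ e _ i)) (%-nonneg _ (x (inject₁ i))))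
                                (subst (+ 0 ℤ.≤_) (sym (∷ʳ-fromℕ e _)) (%-nonneg _ (x (q m) ℤ.- sumℤ e)))
    E<ℓ : ∀ v → E v ℤ.< + ℓ v
    E<ℓ = inject₁-fromℕ-elim _ (λ i → subst (ℤ._< + ℓ (inject₁ i)) (sym (∷ʳ-inject₁ e _ i)) (%-< _ (x (inject₁ i))))
                                (subst (ℤ._< + ℓ (q m)) (sym (∷ʳ-fromℕ e _)) (%-< _ (x (q m) ℤ.- sumℤ e)))
    e≡x : ∀ i → E (inject₁ i) ≡ x (inject₁ i) mod ℓ (inject₁ i)
    e≡x i = subst (_≡ _ mod _) (sym (∷ʳ-inject₁ e _ i)) (%-≡-mod _ (x (inject₁ i)))
    E-D∈Im : InIm (Lred A) (λ i → E (inject₁ i) ℤ.- D (inject₁ i))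
    E-D∈Im = H-shift (y , λ i → trans (cong (ℤ._- D (inject₁ i)) (w≡D+L̃y i)) ([i+j]-i≡j (D (inject₁ i)) _))
                     (-‿congᵛ-mod (λ i → ≡-mod-trans (e≡x i) (≡mod (x≡w (inject₁ i)))) ≡ᵛ-mod-refl)
    E≡x : ∀ v → resDeg E v ≡ x v mod ℓ v
    E≡x = inject₁-fromℕ-elim _ (λ i → subst (_≡ _ mod _) (sym (resDeg-inject₁ E i)) (e≡x i))
      (subst (_≡ x (q m) mod ℓ (q m)) (sym (trans (resDeg-q E) (degD-∷ʳ e _)))
        (subst (sumℤ e ℤ.+ (x (q m) ℤ.- sumℤ e) % ℓ (q m) ≡_mod ℓ (q m)) (i+[j-i]≡j (sumℤ e) (x (q m)))
          (+-cong-mod (≡⇒≡-mod {a = sumℤ e} refl) (%-≡-mod _ (x (q m) ℤ.- sumℤ e)))))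

  open BoxEncoding ℓ′ (ℓ≢0 ∘ inject₁)

  jacobianRep : Fin J → Div (suc m)
  jacobianRep a = dec (repAt a) ∷ʳ - sumℤ (dec (repAt a))

  degD-jacobianRep : ∀ a → degD (jacobianRep a) ≡ + 0
  degD-jacobianRep a = trans (degD-∷ʳ (dec (repAt a)) _) (ℤP.+-inverseʳ (sumℤ (dec (repAt a))))

  cardJac : CardJac A J
  cardJac = jacobianRep , degD-jacobianRep , injective , onto
    where
    injective : ∀ a a′ → LinEq A (jacobianRep a) (jacobianRep a′) → a ≡ a′
    injective a a′ Da∼Da′ = repAt-injective a a′ (IsRep-~⇒≡ (repAt-IsRep a) (repAt-IsRep a′)
      (InIm-cong (λ i → cong₂ ℤ._-_ (∷ʳ-inject₁ (dec (repAt a)) _ i) (∷ʳ-inject₁ (dec (repAt a′)) _ i))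
                 (InImL⇒InIm-Lred Da∼Da′)))
    onto : ∀ D → degD D ≡ + 0 → Σ (Fin J) λ a → LinEq A D (jacobianRep a)
    onto D degD≡0 = a , InIm-Lred⇒InImL deg≡0 (H-shift (~-sym (rep-~ x)) D-Da≡x-rx)
      where
      x = enc (D ∘ inject₁)
      a = proj₁ (repAt-onto (rep x) (rep-IsRep x))
      rx≡ra : rep x ≡ repAt a
      rx≡ra = proj₂ (repAt-onto (rep x) (rep-IsRep x))
      deg≡0 : degD (λ v → D v ℤ.- jacobianRep a v) ≡ + 0
      deg≡0 = trans (∑-- D (jacobianRep a)) (cong₂ ℤ._-_ degD≡0 (degD-jacobianRep a))
      D-Da≡x-rx : (λ i → D (inject₁ i) ℤ.- jacobianRep a (inject₁ i))
                ≡ᵛ (λ i → dec x i ℤ.- dec (rep x) i) mod ℓ′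
      D-Da≡x-rx = -‿congᵛ-mod (≡ᵛ-mod-sym (decode-encode-≡ᵛ (D ∘ inject₁)))
                    (λ i → ≡⇒≡-mod (trans (∷ʳ-inject₁ (dec (repAt a)) _ i) (cong (λ r → dec r i) (sym rx≡ra))))

  module _ (D : Div (suc m)) (degD≡0 : degD D ≡ + 0) where

    shifted : Fin c → Fin m → ℤ
    shifted b i = D (inject₁ i) ℤ.+ dec (elemAt b) i

    standardRep : Fin (ℓ (q m)) → Fin c → Div (suc m)
    standardRep a b = (λ i → shifted b i % ℓ′ i) ∷ʳ + Fin.toℕ a

    standardRep-inject₁ : ∀ a b i → standardRep a b (inject₁ i) ≡ shifted b i % ℓ′ i
    standardRep-inject₁ a b = ∷ʳ-inject₁ (λ i → shifted b i % ℓ′ i) _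

    standardRep-q : ∀ a b → standardRep a b (q m) ≡ + Fin.toℕ a
    standardRep-q a b = ∷ʳ-fromℕ (λ i → shifted b i % ℓ′ i) _

    standardRep-InS : ∀ a b → InS A ℓ D (standardRep a b)
    standardRep-InS a b = InIm⇒InS {D} {standardRep a b} degD≡0 E≥0 E<ℓ (H-shift (elemAt-H b) E-D≡t)
      where
      E-D≡t : ∀ i → standardRep a b (inject₁ i) ℤ.- D (inject₁ i) ≡ dec (elemAt b) i mod ℓ′ i
      E-D≡t i = subst (λ e → e ℤ.- D (inject₁ i) ≡ _ mod ℓ′ i) (sym (standardRep-inject₁ a b i))
        (≡-mod-trans (+-cong-mod (%-≡-mod (ℓ′ i) (shifted b i)) (≡⇒≡-mod {a = - D (inject₁ i)} refl))
                     (≡⇒≡-mod ([i+j]-i≡j (D (inject₁ i)) (dec (elemAt b) i))))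
      E≥0 : Effective (standardRep a b)
      E≥0 = inject₁-fromℕ-elim _
        (λ i → subst (+ 0 ℤ.≤_) (sym (standardRep-inject₁ a b i)) (%-nonneg (ℓ′ i) (shifted b i)))
        (subst (+ 0 ℤ.≤_) (sym (standardRep-q a b)) (+≤+ ℕ.z≤n))
      E<ℓ : ∀ v → standardRep a b v ℤ.< + ℓ v
      E<ℓ = inject₁-fromℕ-elim _
        (λ i → subst (ℤ._< + ℓ′ i) (sym (standardRep-inject₁ a b i)) (%-< (ℓ′ i) (shifted b i)))
        (subst (ℤ._< + ℓ (q m)) (sym (standardRep-q a b)) (+<+ (FinP.toℕ<n a)))

    standardRep-injective : ∀ {a a′ b b′} → PtEq (standardRep a b) (standardRep a′ b′) → a ≡ a′ × b ≡ b′
    standardRep-injective {a} {a′} {b} {b′} eq =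
      FinP.toℕ-injective (ℤP.+-injective (trans (sym (standardRep-q a b)) (trans (eq (q m)) (standardRep-q a′ b′)))) ,
      elemAt-injective b b′ (decode-≡ᵛ⇒≡ λ i → +-cancelˡ-mod {z = D (inject₁ i)} (%-≡⇒≡-mod (ℓ′ i)
        (trans (sym (standardRep-inject₁ a b i)) (trans (eq (inject₁ i)) (standardRep-inject₁ a′ b′ i)))))

    standardRep-onto : ∀ E → InS A ℓ D E → Σ (Fin (ℓ (q m))) λ a → Σ (Fin c) λ b → PtEq E (standardRep a b)
    standardRep-onto E E∈S@((E≥0 , _) , E<ℓ) = a , b , inject₁-fromℕ-elim _ agree-inject₁ agree-q
      where
      a = proj₁ (bounded⇒Fin (E≥0 (q m)) (E<ℓ (q m)))
      t = enc (λ i → E (inject₁ i) ℤ.- D (inject₁ i))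
      t-H : InIm (Lred A) (dec t)
      t-H = H-shift (InS⇒InIm {D} {E} E∈S) (decode-encode-≡ᵛ _)
      b = proj₁ (elemAt-onto t t-H)
      agree-q : E (q m) ≡ standardRep a b (q m)
      agree-q = trans (proj₂ (bounded⇒Fin (E≥0 (q m)) (E<ℓ (q m)))) (sym (standardRep-q a b))
      shifted≡E : ∀ i → shifted b i ≡ E (inject₁ i) mod ℓ′ i
      shifted≡E i = subst (λ j → D (inject₁ i) ℤ.+ dec j i ≡ E (inject₁ i) mod ℓ′ i) (proj₂ (elemAt-onto t t-H))
        (≡-mod-trans (+-cong-mod (≡⇒≡-mod {a = D (inject₁ i)} refl) (decode-encode-≡ᵛ _ i))
                     (≡⇒≡-mod (i+[j-i]≡j (D (inject₁ i)) (E (inject₁ i)))))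
      agree-inject₁ : ∀ i → E (inject₁ i) ≡ standardRep a b (inject₁ i)
      agree-inject₁ i = sym (trans (standardRep-inject₁ a b i)
        (trans (≡-mod⇒%-≡ (ℓ′ i) (shifted≡E i)) (%-bounded (ℓ′ i) (E≥0 (inject₁ i)) (E<ℓ (inject₁ i)))))

    cardS : CardS A ℓ D (ℓ (q m) ℕ.* c)
    cardS = standardRepAt , (λ k → standardRep-InS _ _) ,
            (λ k k′ → unpairing-injective {ℓ (q m)} {c} PtEq standardRep standardRep-injective) , onto
      where
      standardRepAt : Fin (ℓ (q m) ℕ.* c) → Div (suc m)
      standardRepAt k = standardRep (proj₁ (Fin.remQuot {ℓ (q m)} c k)) (proj₂ (Fin.remQuot {ℓ (q m)} c k))
      onto : ∀ E → InS A ℓ D E → Σ (Fin (ℓ (q m) ℕ.* c)) λ k → PtEq E (standardRepAt k)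
      onto E E∈S = let (a , b , E≡) = standardRep-onto E E∈S in
        Fin.combine a b ,
        subst (λ p → PtEq E (standardRep (proj₁ p) (proj₂ p))) (sym (FinP.remQuot-combine {ℓ (q m)} {c} a b)) E≡

  cardS-cardJac : ℓ (q m) ℕ.* c ℕ.* J ≡ prodℕ ℓ
  cardS-cardJac = begin
    ℓ (q m) ℕ.* c ℕ.* J  ≡⟨ ℕP.*-comm (ℓ (q m) ℕ.* c) J ⟩
    J ℕ.* (ℓ (q m) ℕ.* c) ≡⟨ cong (J ℕ.*_) (ℕP.*-comm (ℓ (q m)) c) ⟩
    J ℕ.* (c ℕ.* ℓ (q m)) ≡⟨ ℕP.*-assoc J c (ℓ (q m)) ⟨
    J ℕ.* c ℕ.* ℓ (q m)   ≡⟨ cong (ℕ._* ℓ (q m)) index-count ⟨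
    B ℕ.* ℓ (q m)         ≡⟨ prodℕ-init-last ℓ ⟨
    prodℕ ℓ               ∎
    where open ≡-Reasoning

open import Data.Nat using (_*_)

proposition3p4 : (m : ℕ) (A : Adj (suc m)) → Symmetric A → Connected A →
    (ℓ : Fin (suc m) → ℕ) → (∀ v → PosMultOfOrd A v (ℓ v)) →
    -- (1)
    ((Σ (Fin m → Fin m → ℚ) λ M → IsInverseℚ (Lred A) M)
      × (∀ M → IsInverseℚ (Lred A) M → ∀ v → IsOrd A (inject₁ v) (lcmDenCol M v)))
    -- (2)
    × (∀ D → degD D ≡ + 0 →
        (∀ E → InS A ℓ D E → InH A ℓ D (resDeg E))
        × (∀ E E' → InS A ℓ D E → InS A ℓ D E' → ModEq ℓ (resDeg E) (resDeg E') → PtEq E E')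
        × (∀ x → InH A ℓ D x → Σ (Div (suc m)) λ E → InS A ℓ D E × ModEq ℓ (resDeg E) x))
    -- (3)
    × (∀ D → degD D ≡ + 0 →
        Σ ℕ λ N → Σ ℕ λ J → CardS A ℓ D N × CardJac A J × N * J ≡ prodℕ ℓ)
proposition3p4 m A A-sym _ ℓ ℓ-mult =
  (Lred⁻¹ , λ M M⁻¹ v →
    IsLeastMultipleInIm⇒IsOrd v _ (RationalInverse.lcmDenCol-least (Lred A) M M⁻¹ v (ord-multiple v))) ,
  (λ D degD≡0 → (λ E → InS⇒InH {D} {E}) , (λ E E′ → InS-unique {D} {E} {E′}) , InH⇒InS {D} degD≡0) ,
  (λ D degD≡0 → _ , _ , cardS D degD≡0 , cardJac , cardS-cardJac)
  where
  open SymmetricLaplacian A A-sym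
  open StandardRepresentatives A A-sym ℓ ℓ-mult
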